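{- Let $r\ge2$, write $D_1=(q)_{s_1-s_2}\cdots(q)_{s_{r-2}-s_{r-1}}(q)_{s_{r-1}}$, $D_2=(q)_{s_1-s_2}\cdots(q)_{s_{r-2}-s_{r-1}}(q^2;q^2)_{s_{r-1}}$, $\Sigma=s_1^2+\cdots+s_{r-1}^2$, $N_i=\Sigma-s_1-\cdots-s_i$ (empty sums are $0$), let all multisums run over $s_1\ge\cdots\ge s_{r-1}\ge0$, and $GF(\mathcal{X})=\sum_{(\mu,\lambda)\in\mathcal{X}}q^{|(\mu,\lambda)|}$. Then: $GF(\mathcal{Q}_{i-1,r})=\sum\frac{q^{\Sigma+s_i+\cdots+s_{r-1}}}{D_1}$, $GF(\mathcal{S}_{i-1,r})=\sum\frac{q^{\Sigma+s_i+\cdots+s_{r-1}}}{D_2}$, $GF(\tilde{\mathcal{S}}_{i-1,r})=\sum\frac{q^{\Sigma+(s_i+\cdots+s_{r-1})+s_{r-1}}}{D_2}$, for $1\le i\le r$; $GF(\mathcal{P}_{i,r})=\sum\frac{q^{N_i}}{D_1}$, $GF(\mathcal{R}_{i,r})=\sum\frac{q^{N_i}}{D_2}$, $GF(\tilde{\mathcal{R}}_{i,r})=\sum\frac{q^{N_i+s_{r-1}}}{D_2}$, for $0\le i\le r-1$; $GF(\mathcal{P}_{i,r}\setminus\mathcal{P}_{i-1,r})=\sum\frac{q^{N_i}(1-q^{s_i})}{D_1}$, $GF(\mathcal{R}_{i,r}\setminus\tilde{\mathcal{R}}_{i-1,r})=\sum\frac{q^{N_i}(1-q^{s_i+s_{r-1}})}{D_2}$,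 $GF(\tilde{\mathcal{R}}_{i,r}\setminus\mathcal{R}_{i-1,r})=\sum\frac{q^{N_i}(q^{s_{r-1}}-q^{s_i})}{D_2}$, for $1\le i\le r-1$; $GF(\mathcal{R}_{i,r}\setminus\mathcal{R}_{i-2,r})=\sum\frac{q^{N_i}(1-q^{s_i+s_{i-1}})}{D_2}$, $GF(\tilde{\mathcal{R}}_{i,r}\setminus\tilde{\mathcal{R}}_{i-2,r})=\sum\frac{q^{N_i+s_{r-1}}(1-q^{s_i+s_{i-1}})}{D_2}$, for $2\le i\le r-1$.
   Context: $|q|<1$; $(a;q)_k=\prod_{j=0}^{k-1}(1-aq^j)$, $(q)_k=(q;q)_k$. For integers $s_1\ge\cdots\ge s_{r-1}\ge0$ set $s_0=\infty$, $s_r=0$; $\mu(s_1,\ldots,s_{r-1})$ is the partition (zero parts allowed) whose multiplicity sequence satisfies $(f_{2u},f_{2u+1})=(j,0)$ for $j\in\{0,\ldots,r-1\}$ and $s_{j+1}\le u<s_j$; its weight is $\sum_u uf_u$. $\mathcal{P}(s_1,\ldots,s_{r-1})$ is the set of sequences $\lambda=(\lambda_0,\ldots,\lambda_{s_1-1})$ of non-negative integers with $\lambda_{s_{j+1}}\le\lambda_{s_{j+1}+1}\le\cdots\le\lambda_{s_j-1}$ for each $1\le j\le r-1$; $|\lambda|=\sum\lambda_k$. For $0\le i\le r-1$ define subsets of $\mathcal{P}(s_1,\ldots,s_{r-1})$ (the lower bounds on $\lambda_{s_{j+1}}$ being imposed for those $j$ with $s_{j+1}<s_j$): $\mathcal{P}_{i,r}(s)$: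 $\lambda_{s_{j+1}}\ge j-i$ for all $1\le j\le r-1$; $\mathcal{R}_{i,r}(s)$ (resp. $\tilde{\mathcal{R}}_{i,r}(s)$): elements of $\mathcal{P}_{i,r}(s)$ with $\lambda_0,\ldots,\lambda_{s_{r-1}-1}$ all $\equiv r-1-i$ (resp. $\equiv r-i$) mod $2$; $\mathcal{Q}_{i,r}(s)$: $\lambda_{s_{j+1}}\ge j+\max\{j-i,0\}$ for all $1\le j\le r-1$; $\mathcal{S}_{i,r}(s)$ (resp. $\tilde{\mathcal{S}}_{i,r}(s)$): elements of $\mathcal{Q}_{i,r}(s)$ with $\lambda_0,\ldots,\lambda_{s_{r-1}-1}$ all $\equiv i$ (resp. $\equiv i-1$) mod $2$. For $\mathcal{L}\in\{\mathcal{P},\mathcal{Q},\mathcal{R},\tilde{\mathcal{R}},\mathcal{S},\tilde{\mathcal{S}}\}$, $\mathcal{L}_{i,r}=\bigsqcup_{s_1\ge\cdots\ge s_{r-1}\ge0}\{\mu(s_1,\ldots,s_{r-1})\}\times\mathcal{L}_{i,r}(s_1,\ldots,s_{r-1})$, with weight $|(\mu,\lambda)|=|\mu|+|\lambda|$. Conventions: $\mathcal{L}_{ -1,r}$ is defined by the same formulas with $i=-1$. -}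

module Defs where

open import Data.Nat using (ℕ; zero; suc; _+_; _*_; _∸_; _≤_; _<_; _^_; _%_)
open import Data.Nat.Properties using (_≟_)
open import Data.Integer as ℤ using (ℤ; +_)
open import Data.List using (List; []; _∷_; length; map; upTo; concatMap)
open import Data.Nat.ListAction using (sum)
open import Data.List.Membership.Propositional using (_∈_)
open import Data.List.Relation.Unary.Unique.Propositional using (Unique)
open import Data.Product using (Σ; Σ-syntax; _×_)
open import Relation.Nullary using (¬_; yes; no)
open import Relation.Binary.PropositionalEquality using (_≡_)

-- k-th entry of a list (0-based), 0 when out of range
at : List ℕ → ℕ → ℕ
at []       _       = 0
at (x ∷ _)  zero    = x
at (_ ∷ xs) (suc k) = at xs k

sumFrom : ℕ → ℕ → (ℕ → ℕ) → ℕ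
sumFrom a b f = sum (map (λ k → f (a + k)) (upTo (b ∸ a)))

-- s is stored as the list (s_1 , … , s_{r-1}); s_j for j ≥ 1.
-- Since the list has length r-1, sj s r = 0 = s_r automatically.
sj : List ℕ → ℕ → ℕ
sj s j = at s (j ∸ 1)

-- Elements of the disjoint unions: pairs (s , λ), s = (s_1,…,s_{r-1}),
-- λ = (λ_0,…,λ_{s_1-1}); μ = μ(s) is determined by s.

Elem : Set
Elem = List ℕ × List ℕ

Admissible : ℕ → List ℕ → Set
Admissible r s = (length s ≡ r ∸ 1)
  × (∀ j → 1 ≤ j → suc j ≤ r ∸ 1 → sj s (suc j) ≤ sj s j)

InP : ℕ → List ℕ → List ℕ → Set
InP r s l = (length l ≡ sj s 1)
  × (∀ j → 1 ≤ j → j ≤ r ∸ 1 → ∀ k → sj s (suc j) ≤ k → suc k < sj s j →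
       at l k ≤ at l (suc k))

LowerB : ℕ → (ℕ → ℕ) → List ℕ → List ℕ → Set
LowerB r b s l = ∀ j → 1 ≤ j → j ≤ r ∸ 1 → sj s (suc j) < sj s j →
  b j ≤ at l (sj s (suc j))

Parity : ℕ → ℕ → List ℕ → List ℕ → Set
Parity r p s l = ∀ k → k < sj s (r ∸ 1) → at l k % 2 ≡ p % 2

Univ : ℕ → Elem → Set
Univ r (s Data.Product., l) = Admissible r s × InP r s l

open Data.Product using (_,_)

-- 𝒫_{i,r}: λ_{s_{j+1}} ≥ j - i  (as naturals, j ∸ i; λ ≥ 0 anyway)
𝒫 : ℕ → ℕ → Elem → Set
𝒫 r i (s , l) = Univ r (s , l) × LowerB r (λ j → j ∸ i) s l

ℛ : ℕ → ℕ → Elem → Set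
ℛ r i (s , l) = 𝒫 r i (s , l) × Parity r (r ∸ 1 ∸ i) s l

ℛ̃ : ℕ → ℕ → Elem → Set
ℛ̃ r i (s , l) = 𝒫 r i (s , l) × Parity r (r ∸ i) s l

𝒬 : ℕ → ℕ → Elem → Set
𝒬 r i (s , l) = Univ r (s , l) × LowerB r (λ j → j + (j ∸ i)) s l

𝒮 : ℕ → ℕ → Elem → Set
𝒮 r i (s , l) = 𝒬 r i (s , l) × Parity r i s l

-- 𝒮̃_{i,r}: parity i-1, i.e. i+1 mod 2
𝒮̃ : ℕ → ℕ → Elem → Set
𝒮̃ r i (s , l) = 𝒬 r i (s , l) × Parity r (suc i) s l

_∖_ : (Elem → Set) → (Elem → Set) → Elem → Set
(A ∖ B) x = A x × ¬ B x

-- Weight of μ(s): multiplicities f_{2u} = j for s_{j+1} ≤ u < s_j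
-- (1 ≤ j ≤ r-1; the j = 0 range contributes multiplicity 0), f_{2u+1} = 0.

inRange : ℕ → ℕ → ℕ → ℕ
inRange a b u with suc u Data.Nat.≤? b | a Data.Nat.≤? u
... | yes _ | yes _ = 1
... | _     | _     = 0

mult : ℕ → List ℕ → ℕ → ℕ
mult r s v with v % 2 ≟ 0
... | no _  = 0
... | yes _ = sumFrom 1 r (λ j → j * inRange (sj s (suc j)) (sj s j) (Data.Nat._/_ v 2))

-- |μ| = Σ_v v f_v  (all nonzero multiplicities occur for v < 2 s_1)
weightμ : ℕ → List ℕ → ℕ
weightμ r s = sumFrom 0 (2 * sj s 1) (λ v → v * mult r s v)

weight : ℕ → Elem → ℕ
weight r (s , l) = weightμ r s + sum l

Count : ℕ → (Elem → Set) → ℕ → ℕ → Set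
Count r A n c = Σ[ L ∈ List Elem ] Unique L
  × (∀ x → x ∈ L → A x × weight r x ≡ n)
  × (∀ x → A x → weight r x ≡ n → x ∈ L)
  × length L ≡ c

FPS : Set
FPS = ℕ → ℤ

sumℤ : List ℤ → ℤ
sumℤ []       = + 0
sumℤ (x ∷ xs) = x ℤ.+ sumℤ xs

_⊕_ : FPS → FPS → FPS
(f ⊕ g) n = f n ℤ.+ g n

_⊖_ : FPS → FPS → FPS
(f ⊖ g) n = f n ℤ.- g n

_⊗_ : FPS → FPS → FPS
(f ⊗ g) n = sumℤ (map (λ k → f k ℤ.* g (n ∸ k)) (upTo (suc n)))

oneS : FPS
oneS zero    = + 1
oneS (suc _) = + 0

qpow : ℕ → FPS
qpow a n with a ≟ n
... | yes _ = + 1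
... | no  _ = + 0

prodS : List FPS → FPS
prodS []       = oneS
prodS (f ∷ fs) = f ⊗ prodS fs

-- 1/(1 - q^{suc a}) = Σ_m q^{m (suc a)}
geomInv : ℕ → FPS
geomInv a n with n % suc a ≟ 0
... | yes _ = + 1
... | no  _ = + 0

-- 1/(q;q)_k = ∏_{j<k} 1/(1-q^{j+1})
invPoch : ℕ → FPS
invPoch k = prodS (map (λ j → geomInv j) (upTo k))

-- 1/(q²;q²)_k = ∏_{j<k} 1/(1-q^{2j+2})
invPoch2 : ℕ → FPS
invPoch2 k = prodS (map (λ j → geomInv (suc (2 * j))) (upTo k))

invD1 : ℕ → List ℕ → FPS
invD1 r s = prodS (map (λ k → invPoch (sj s (suc k) ∸ sj s (suc (suc k)))) (upTo (r ∸ 1)))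

invD2 : ℕ → List ℕ → FPS
invD2 r s = prodS (map (λ k → invPoch (sj s (suc k) ∸ sj s (suc (suc k)))) (upTo (r ∸ 2)))
            ⊗ invPoch2 (sj s (r ∸ 1))

Sig : ℕ → List ℕ → ℕ
Sig r s = sumFrom 1 r (λ j → sj s j * sj s j)

sRange : List ℕ → ℕ → ℕ → ℕ
sRange s a b = sumFrom a b (sj s)

-- N_i = Σ - s_1 - ⋯ - s_i  (always ≥ 0)
Nn : ℕ → ℕ → List ℕ → ℕ
Nn r i s = Sig r s ∸ sRange s 1 (suc i)

decs : ℕ → ℕ → List (List ℕ)
decs zero    B = [] ∷ []
decs (suc m) B = concatMap (λ x → map (x ∷_) (decs m x)) (upTo (suc B))

partialCoeff : ℕ → (List ℕ → FPS) → ℕ → ℕ → ℤ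
partialCoeff r T B n = sumℤ (map (λ s → T s n) (decs (r ∸ 1) B))

-- the coefficient of q^n in the (formally convergent) multisum Σ_s T s is c:
-- the partial sums over s_1 ≤ B stabilise at c
MultisumCoeff : ℕ → (List ℕ → FPS) → ℕ → ℤ → Set
MultisumCoeff r T n c = Σ[ B ∈ ℕ ] (∀ B′ → B ≤ B′ → partialCoeff r T B′ n ≡ c)

GFEq : ℕ → (Elem → Set) → (List ℕ → FPS) → Set
GFEq r A T = ∀ n → Σ[ c ∈ ℕ ] (Count r A n c × MultisumCoeff r T n (+ c))

-- For a fixed s the conditions on λ split into independent runs λ_{s_{j+1}}, …, λ_{s_j - 1}:
-- the run for j is nondecreasing with entries at least b_j, and the lowest run may in addition
-- have all its entries of one parity.  Subtracting b_j from a run of length d and reading the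
-- increments as part multiplicities shows that such a run has generating function
-- q^{b_j d} / (q;q)_d, or q^{b_j d} / (q²;q²)_d in the parity case once b_j is raised to the
-- required parity.  So the fibre over s contributes q^{|μ(s)| + Σ_j b_j (s_j - s_{j+1})} / D,
-- and since |μ(s)| = Σ_j s_j (s_j - 1), this exponent is N_i for b_j = max (j - i, 0) and
-- Σ + s_{i+1} + ⋯ + s_{r-1} for b_j = j + max (j - i, 0).  In the last two groups the subtracted
-- set is contained in the other one, so the generating functions subtract.
--
-- A generating function is certified by a duplicate-free list of the elements of each weight.
-- Two certificates for the same weighted set give the same series; this is also how
-- associativity and commutativity of ⊗ are obtained for the series that occur.
module Submission where

open import Defs
open import Data.Bool using (true; false)
open import Data.Empty using (⊥; ⊥-elim)
open import Data.Integer as ℤ using (ℤ)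
  renaming (_+_ to _+ℤ_; _-_ to _-ℤ_; _*_ to _*ℤ_)
import Data.Integer.Properties as ℤ
import Data.Integer.Tactic.RingSolver as ℤ-Solver
open import Data.List
  using (List; []; _∷_; _++_; length; map; upTo; concatMap; cartesianProduct; take; drop; filter)
import Data.List.Properties as List
open import Data.List.Properties
  using (length-++; length-map; length-++-sucʳ; upTo-∷ʳ; length-take; length-drop; take++drop≡id;
         map-applyUpTo; map-++; map-id; map-cong; ∷-injectiveʳ)
open import Data.List.Membership.Propositional using (_∈_; lose; find)
open import Data.List.Membership.Propositional.Properties
  using (∈-map⁺; ∈-map⁻; ∈-∃++; ∈-concatMap⁺; ∈-concatMap⁻; ∈-upTo⁺; ∈-upTo⁻;
         ∈-cartesianProduct⁺; ∈-cartesianProduct⁻; ∈-++⁻; ∈-++⁺ˡ; ∈-++⁺ʳ;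
         ∈-filter⁺; ∈-filter⁻)
open import Data.List.Relation.Unary.All as All using (All; []; _∷_)
open import Data.List.Relation.Unary.AllPairs using ([]; _∷_)
open import Data.List.Relation.Unary.Any using (Any; here; there)
open import Data.List.Relation.Unary.Unique.Propositional using (Unique)
import Data.List.Relation.Unary.Unique.Propositional.Properties as Unique
open import Data.Nat as ℕ
  using (ℕ; zero; suc; _+_; _*_; _∸_; _≤_; _<_; z≤n; s≤s; _<?_; _≤?_; _⊔_; NonZero)
open import Data.Nat.Properties
open import Algebra.Properties.CommutativeSemigroup +-commutativeSemigroup
  using (interchange; xy∙z≈xz∙y; x∙yz≈y∙xz)
open import Data.Nat.DivMod
  using (_/_; _%_; m≡m%n+[m/n]*n; m*n%n≡0; m*n/n≡m; m/n*n≡m; [m+kn]%n≡m%n; n%1≡0; %-distribˡ-+)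
open import Data.Nat.Divisibility using (_∣_; divides)
open import Data.Nat.ListAction using (sum)
open import Data.Nat.ListAction.Properties using (sum-++)
open import Data.Nat.Tactic.RingSolver using (solve-∀)
open import Data.Product using (_×_; _,_; proj₁; proj₂)
import Data.Product.Properties as Product
open import Data.Sum using (inj₁; inj₂)
open import Data.Unit using (⊤; tt)
open import Function using (_∘_; id; _⇔_; mk⇔; module Equivalence)
open import Relation.Binary.PropositionalEquality
open import Relation.Nullary using (¬_; Dec; yes; no; ¬?; does)
open import Relation.Nullary.Decidable using (_×-dec_; map′)
open import Relation.Unary using (Decidable)
open import Data.List.Membership.DecPropositional (Product.≡-dec (List.≡-dec ℕ._≟_) (List.≡-dec ℕ._≟_))
  using (_∈?_)

sumℤ-cong : ∀ {A : Set} {F G : A → ℤ} ks → (∀ {k} → k ∈ ks → F k ≡ G k) →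
            sumℤ (map F ks) ≡ sumℤ (map G ks)
sumℤ-cong []       eq = refl
sumℤ-cong (k ∷ ks) eq = cong₂ _+ℤ_ (eq (here refl)) (sumℤ-cong ks (eq ∘ there))

sumℤ-map-- : ∀ {A : Set} (F G : A → ℤ) ks →
             sumℤ (map (λ k → F k -ℤ G k) ks) ≡ sumℤ (map F ks) -ℤ sumℤ (map G ks)
sumℤ-map-- F G []       = refl
sumℤ-map-- F G (k ∷ ks) =
  trans (cong ((F k -ℤ G k) +ℤ_) (sumℤ-map-- F G ks)) (regroup (F k) (G k) _ _)
  where
  regroup : ∀ a b c d → (a -ℤ b) +ℤ (c -ℤ d) ≡ (a +ℤ c) -ℤ (b +ℤ d)
  regroup = ℤ-Solver.solve-∀

sumℤ-length : ∀ {A B : Set} {G : A → ℤ} (F : A → List B) ks →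
              (∀ {k} → k ∈ ks → G k ≡ ℤ.+ length (F k)) →
              sumℤ (map G ks) ≡ ℤ.+ length (concatMap F ks)
sumℤ-length F []       eq = refl
sumℤ-length F (k ∷ ks) eq =
  trans (cong₂ _+ℤ_ (eq (here refl)) (sumℤ-length F ks (eq ∘ there)))
        (trans (sym (ℤ.pos-+ (length (F k)) _)) (cong ℤ.+_ (sym (length-++ (F k)))))

⊗-cong : ∀ {f f′ g g′} → f ≗ f′ → g ≗ g′ → f ⊗ g ≗ f′ ⊗ g′
⊗-cong f≗ g≗ n = sumℤ-cong (upTo (suc n)) (λ {k} _ → cong₂ _*ℤ_ (f≗ k) (g≗ (n ∸ k)))

⊗-congˡ : ∀ f {g g′} → g ≗ g′ → f ⊗ g ≗ f ⊗ g′
⊗-congˡ f = ⊗-cong {f} (λ _ → refl)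

⊗-congʳ : ∀ g {f f′} → f ≗ f′ → f ⊗ g ≗ f′ ⊗ g
⊗-congʳ g f≗ = ⊗-cong {g = g} f≗ (λ _ → refl)

⊗-distribˡ-⊖ : ∀ f g h → f ⊗ (g ⊖ h) ≗ (f ⊗ g) ⊖ (f ⊗ h)
⊗-distribˡ-⊖ f g h n =
  trans (sumℤ-cong (upTo (suc n)) (λ {k} _ → distrib (f k) (g (n ∸ k)) (h (n ∸ k))))
        (sumℤ-map-- (λ k → f k *ℤ g (n ∸ k)) (λ k → f k *ℤ h (n ∸ k)) (upTo (suc n)))
  where
  distrib : ∀ a b c → a *ℤ (b -ℤ c) ≡ a *ℤ b -ℤ a *ℤ c
  distrib = ℤ-Solver.solve-∀

⊗-distribʳ-⊖ : ∀ f g h → (f ⊖ g) ⊗ h ≗ (f ⊗ h) ⊖ (g ⊗ h)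
⊗-distribʳ-⊖ f g h n =
  trans (sumℤ-cong (upTo (suc n)) (λ {k} _ → distrib (f k) (g k) (h (n ∸ k))))
        (sumℤ-map-- (λ k → f k *ℤ h (n ∸ k)) (λ k → g k *ℤ h (n ∸ k)) (upTo (suc n)))
  where
  distrib : ∀ a b c → (a -ℤ b) *ℤ c ≡ a *ℤ c -ℤ b *ℤ c
  distrib = ℤ-Solver.solve-∀

length-mono-⊆ : ∀ {A : Set} {xs ys : List A} → Unique xs →
                (∀ {z} → z ∈ xs → z ∈ ys) → length xs ≤ length ys
length-mono-⊆ {xs = []}     _            _   = z≤n
length-mono-⊆ {xs = x ∷ xs} (x∉xs ∷ xs!) xs⊆ys
  with ys₁ , ys₂ , refl ← ∈-∃++ (xs⊆ys (here refl)) =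
  subst (suc (length xs) ≤_) (sym (length-++-sucʳ ys₁ x ys₂))
    (s≤s (length-mono-⊆ xs! (λ z∈xs → delete (xs⊆ys (there z∈xs)) (All.lookup x∉xs z∈xs ∘ sym))))
  where
  delete : ∀ {z} → z ∈ ys₁ ++ x ∷ ys₂ → z ≢ x → z ∈ ys₁ ++ ys₂
  delete z∈ z≢x with ∈-++⁻ ys₁ z∈
  ... | inj₁ z∈ys₁         = ∈-++⁺ˡ z∈ys₁
  ... | inj₂ (here z≡x)    = ⊥-elim (z≢x z≡x)
  ... | inj₂ (there z∈ys₂) = ∈-++⁺ʳ ys₁ z∈ys₂

length-unique : ∀ {A : Set} {xs ys : List A} → Unique xs → Unique ys →
                (∀ {z} → z ∈ xs → z ∈ ys) → (∀ {z} → z ∈ ys → z ∈ xs) →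
                length xs ≡ length ys
length-unique xs! ys! xs⊆ys ys⊆xs = ≤-antisym (length-mono-⊆ xs! xs⊆ys) (length-mono-⊆ ys! ys⊆xs)

Unique-concatMap : ∀ {A B : Set} (tag : B → A) (F : A → List B) {ks} → Unique ks →
                   (∀ k → Unique (F k)) → (∀ {k z} → z ∈ F k → tag z ≡ k) →
                   Unique (concatMap F ks)
Unique-concatMap tag F {[]}     _            _  _      = []
Unique-concatMap tag F {k ∷ ks} (k∉ks ∷ ks!) F! tagged =
  Unique.++⁺ (F! k) (Unique-concatMap tag F ks! F! tagged) disjoint
  where
  disjoint : ∀ {z} → ¬ (z ∈ F k × z ∈ concatMap F ks)
  disjoint (z∈Fk , z∈rest) = tag-differs k∉ks (∈-concatMap⁻ F z∈rest)
    where
    tag-differs : ∀ {ks′} → All (k ≢_) ks′ → Any ((_ ∈_) ∘ F) ks′ → ⊥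
    tag-differs (k≢ ∷ _)  (here z∈)  = k≢ (trans (sym (tagged z∈Fk)) (tagged z∈))
    tag-differs (_ ∷ k≢s) (there z∈) = tag-differs k≢s z∈

record Enumeration {X : Set} (P : X → Set) (w : X → ℕ) (f : FPS) : Set where
  field
    list     : ℕ → List X
    unique   : ∀ n → Unique (list n)
    sound    : ∀ {n x} → x ∈ list n → P x × w x ≡ n
    complete : ∀ {n x} → P x → w x ≡ n → x ∈ list n
    coeff    : ∀ n → f n ≡ ℤ.+ length (list n)

open Enumeration

module _ {X : Set} {P : X → Set} {w : X → ℕ} where

  Enumeration-unique : ∀ {f g} → Enumeration P w f → Enumeration P w g → f ≗ g
  Enumeration-unique E F n =
    trans (coeff E n) (trans (cong ℤ.+_ (length-unique (unique E n) (unique F n) (⊆ E F) (⊆ F E)))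
                             (sym (coeff F n)))
    where
    ⊆ : ∀ {f g} (E : Enumeration P w f) (F : Enumeration P w g) {x} → x ∈ list E n → x ∈ list F n
    ⊆ E F x∈ = let (px , wx) = sound E x∈ in complete F px wx

  Enumeration-resp-≗ : ∀ {f g} → f ≗ g → Enumeration P w f → Enumeration P w g
  Enumeration-resp-≗ f≗g E = record
    { list = list E ; unique = unique E ; sound = sound E ; complete = complete E
    ; coeff = λ n → trans (sym (f≗g n)) (coeff E n) }

record WeightedBijection {X Y : Set} (P : X → Set) (w : X → ℕ) (Q : Y → Set) (v : Y → ℕ) : Set where
  field
    to        : X → Y
    from      : Y → X
    to-∈      : ∀ {x} → P x → Q (to x)
    from-∈    : ∀ {y} → Q y → P (from y)
    to-from   : ∀ {y} → Q y → to (from y) ≡ y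
    from-to   : ∀ {x} → P x → from (to x) ≡ x
    weight-to : ∀ {x} → P x → v (to x) ≡ w x

module _ {X Y : Set} {P : X → Set} {w : X → ℕ} {Q : Y → Set} {v : Y → ℕ}
         (φ : WeightedBijection P w Q v) where
  open WeightedBijection φ

  transport : ∀ {f} → Enumeration P w f → Enumeration Q v f
  transport E = record
    { list     = λ n → map to (list E n)
    ; unique   = λ n → unique-map (All.tabulate (proj₁ ∘ sound E)) (unique E n)
    ; sound    = λ y∈ → let (x , x∈ , y≡) = ∈-map⁻ to y∈ ; (px , wx) = sound E x∈ in
                   subst Q (sym y≡) (to-∈ px) , trans (cong v y≡) (trans (weight-to px) wx)
    ; complete = λ qy vy → subst (_∈ _) (to-from qy)
                   (∈-map⁺ to (complete E (from-∈ qy)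
                     (trans (sym (weight-to (from-∈ qy))) (trans (cong v (to-from qy)) vy))))
    ; coeff    = λ n → trans (coeff E n) (cong ℤ.+_ (sym (length-map to (list E n))))
    }
    where
    injective : ∀ {x x′} → P x → P x′ → to x ≡ to x′ → x ≡ x′
    injective px px′ eq = trans (sym (from-to px)) (trans (cong from eq) (from-to px′))
    unique-map : ∀ {xs} → All P xs → Unique xs → Unique (map to xs)
    unique-map []         []         = []
    unique-map (px ∷ pxs) (x∉ ∷ xs!) = distinct px pxs x∉ ∷ unique-map pxs xs!
      where
      distinct : ∀ {x ys} → P x → All P ys → All (x ≢_) ys → All (to x ≢_) (map to ys)
      distinct px []         []         = []
      distinct px (py ∷ pys) (x≢ ∷ x≢s) = (x≢ ∘ injective px py) ∷ distinct px pys x≢s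

  bijection-≗ : ∀ {f g} → Enumeration P w f → Enumeration Q v g → f ≗ g
  bijection-≗ E F = Enumeration-unique (transport E) F

reweigh : ∀ {X : Set} {P Q : X → Set} {w v : X → ℕ} → (∀ {x} → P x → Q x) → (∀ {x} → Q x → P x) →
          (∀ {x} → P x → v x ≡ w x) → WeightedBijection P w Q v
reweigh P⇒Q Q⇒P v≡w = record
  { to = id ; from = id ; to-∈ = P⇒Q ; from-∈ = Q⇒P
  ; to-from = λ _ → refl ; from-to = λ _ → refl ; weight-to = v≡w }

module _ {X Y : Set} {P : X → Set} {Q : Y → Set} {w : X → ℕ} {v : Y → ℕ} {f g : FPS} where

  infixr 7 _⊗ᴱ_

  _⊗ᴱ_ : Enumeration P w f → Enumeration Q v g →
         Enumeration (λ (x , y) → P x × Q y) (λ (x , y) → w x + v y) (f ⊗ g)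
  E ⊗ᴱ F = record
    { list     = pairs
    ; unique   = λ n → Unique-concatMap (w ∘ proj₁) (split n) (Unique.upTo⁺ (suc n))
                   (λ k → Unique.cartesianProduct⁺ (unique E k) (unique F (n ∸ k)))
                   (λ z∈ → proj₂ (sound E (proj₁ (∈-cartesianProduct⁻ (list E _) (list F _) z∈))))
    ; sound    = pairs-sound
    ; complete = pairs-complete
    ; coeff    = λ n → sumℤ-length (split n) (upTo (suc n)) λ {k} _ →
                   trans (cong₂ _*ℤ_ (coeff E k) (coeff F (n ∸ k)))
                         (trans (sym (ℤ.pos-* (length (list E k)) _))
                                (cong ℤ.+_ (sym (length-cartesianProduct (list E k) (list F (n ∸ k))))))
    }
    where
    split : ℕ → ℕ → List (X × Y)
    split n k = cartesianProduct (list E k) (list F (n ∸ k))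
    pairs : ℕ → List (X × Y)
    pairs n = concatMap (split n) (upTo (suc n))
    pairs-sound : ∀ {n z} → z ∈ pairs n → (P (proj₁ z) × Q (proj₂ z)) × w (proj₁ z) + v (proj₂ z) ≡ n
    pairs-sound {n} z∈ with k , k∈ , z∈k ← find (∈-concatMap⁻ (split n) z∈)
                       with x∈ , y∈ ← ∈-cartesianProduct⁻ (list E k) (list F (n ∸ k)) z∈k =
      let (px , wx) = sound E x∈ ; (qy , vy) = sound F y∈ in
      (px , qy) , trans (cong₂ _+_ wx vy) (m+[n∸m]≡n (≤-pred (∈-upTo⁻ k∈)))
    pairs-complete : ∀ {n z} → P (proj₁ z) × Q (proj₂ z) → w (proj₁ z) + v (proj₂ z) ≡ n → z ∈ pairs n
    pairs-complete {n} {x , y} (px , qy) refl =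
      ∈-concatMap⁺ (split n) (lose (∈-upTo⁺ (s≤s (m≤m+n (w x) (v y))))
        (∈-cartesianProduct⁺ (complete E px refl) (complete F qy (sym (m+n∸m≡n (w x) (v y))))))
    length-cartesianProduct : ∀ {A B : Set} (xs : List A) (ys : List B) →
                              length (cartesianProduct xs ys) ≡ length xs * length ys
    length-cartesianProduct []       ys = refl
    length-cartesianProduct (x ∷ xs) ys =
      trans (length-++ (map (x ,_) ys)) (cong₂ _+_ (length-map _ ys) (length-cartesianProduct xs ys))

qpowEnum : ∀ a → Enumeration {⊤} (λ _ → ⊤) (λ _ → a) (qpow a)
qpowEnum a = record
  { list = atoms ; unique = atoms-unique ; sound = atoms-sound ; complete = atoms-complete
  ; coeff = atoms-coeff }
  where
  atoms : ℕ → List ⊤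
  atoms n with a ℕ.≟ n
  ... | yes _ = tt ∷ []
  ... | no  _ = []
  atoms-unique : ∀ n → Unique (atoms n)
  atoms-unique n with a ℕ.≟ n
  ... | yes _ = [] ∷ []
  ... | no  _ = []
  atoms-sound : ∀ {n x} → x ∈ atoms n → ⊤ × a ≡ n
  atoms-sound {n} x∈ with a ℕ.≟ n | x∈
  ... | yes a≡n | _ = tt , a≡n
  ... | no  _   | ()
  atoms-complete : ∀ {n x} → ⊤ → a ≡ n → x ∈ atoms n
  atoms-complete {n} _ a≡n with a ℕ.≟ n
  ... | yes _   = here refl
  ... | no  a≢n = ⊥-elim (a≢n a≡n)
  atoms-coeff : ∀ n → qpow a n ≡ ℤ.+ length (atoms n)
  atoms-coeff n with a ℕ.≟ n
  ... | yes _ = refl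
  ... | no  _ = refl

oneS≗qpow0 : oneS ≗ qpow 0
oneS≗qpow0 zero    = refl
oneS≗qpow0 (suc n) = refl

geomEnum : ∀ a → Enumeration {ℕ} (λ _ → ⊤) (λ m → m * suc a) (geomInv a)
geomEnum a = record
  { list = quotient ; unique = quotient-unique ; sound = quotient-sound ; complete = quotient-complete
  ; coeff = quotient-coeff }
  where
  quotient : ℕ → List ℕ
  quotient n with n % suc a ℕ.≟ 0
  ... | yes _ = n / suc a ∷ []
  ... | no  _ = []
  quotient-unique : ∀ n → Unique (quotient n)
  quotient-unique n with n % suc a ℕ.≟ 0
  ... | yes _ = [] ∷ []
  ... | no  _ = []
  quotient-sound : ∀ {n m} → m ∈ quotient n → ⊤ × m * suc a ≡ n
  quotient-sound {n} m∈ with n % suc a ℕ.≟ 0 | m∈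
  ... | yes a∣n | here refl = tt , sym (trans (m≡m%n+[m/n]*n n (suc a)) (cong (_+ n / suc a * suc a) a∣n))
  ... | no  _   | ()
  quotient-complete : ∀ {n m} → ⊤ → m * suc a ≡ n → m ∈ quotient n
  quotient-complete {n} {m} _ refl with n % suc a ℕ.≟ 0
  ... | yes _   = here (sym (m*n/n≡m m (suc a)))
  ... | no  a∤n = ⊥-elim (a∤n (m*n%n≡0 m (suc a)))
  quotient-coeff : ∀ n → geomInv a n ≡ ℤ.+ length (quotient n)
  quotient-coeff n with n % suc a ℕ.≟ 0
  ... | yes _ = refl
  ... | no  _ = refl

record Combinatorial (f : FPS) : Set₁ where
  constructor combinatorial
  field
    {Carrier}   : Set
    {Member}    : Carrier → Set
    {size}      : Carrier → ℕ
    enumeration : Enumeration Member size f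

open Combinatorial using (enumeration)

module _ {f g : FPS} (F : Combinatorial f) (G : Combinatorial g) where
  open Combinatorial F renaming (enumeration to E; size to w)
  open Combinatorial G renaming (enumeration to E′; size to v)

  Combinatorial-⊗ : Combinatorial (f ⊗ g)
  Combinatorial-⊗ = combinatorial (E ⊗ᴱ E′)

  ⊗-comm : f ⊗ g ≗ g ⊗ f
  ⊗-comm = bijection-≗ (record
    { to = λ (x , y) → y , x ; from = λ (y , x) → x , y
    ; to-∈ = λ (p , q) → q , p ; from-∈ = λ (q , p) → p , q
    ; to-from = λ _ → refl ; from-to = λ _ → refl
    ; weight-to = λ {(x , y)} _ → +-comm (v y) (w x) })
    (E ⊗ᴱ E′) (E′ ⊗ᴱ E)

  qpow-⊗-interchange : ∀ a b → (qpow a ⊗ f) ⊗ (qpow b ⊗ g) ≗ qpow (a + b) ⊗ (f ⊗ g)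
  qpow-⊗-interchange a b = bijection-≗ (record
    { to = λ ((_ , x) , (_ , y)) → tt , (x , y) ; from = λ (_ , (x , y)) → (tt , x) , (tt , y)
    ; to-∈ = λ ((_ , p) , (_ , q)) → tt , (p , q) ; from-∈ = λ (_ , (p , q)) → (tt , p) , (tt , q)
    ; to-from = λ _ → refl ; from-to = λ _ → refl
    ; weight-to = λ {((_ , x) , (_ , y))} _ → interchange a b (w x) (v y) })
    ((qpowEnum a ⊗ᴱ E) ⊗ᴱ (qpowEnum b ⊗ᴱ E′)) (qpowEnum (a + b) ⊗ᴱ (E ⊗ᴱ E′))

module _ {f : FPS} (F : Combinatorial f) where
  open Combinatorial F renaming (enumeration to E; size to w)

  ⊗-identityˡ : oneS ⊗ f ≗ f
  ⊗-identityˡ = bijection-≗ (record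
    { to = proj₂ ; from = tt ,_ ; to-∈ = proj₂ ; from-∈ = tt ,_
    ; to-from = λ _ → refl ; from-to = λ _ → refl ; weight-to = λ _ → refl })
    (Enumeration-resp-≗ (sym ∘ ⊗-congʳ f oneS≗qpow0) (qpowEnum 0 ⊗ᴱ E)) E

  qpow-⊗-assoc : ∀ a b → qpow a ⊗ (qpow b ⊗ f) ≗ qpow (a + b) ⊗ f
  qpow-⊗-assoc a b = bijection-≗ (record
    { to = λ (_ , (_ , x)) → tt , x ; from = λ (_ , x) → tt , (tt , x)
    ; to-∈ = λ (_ , (_ , p)) → tt , p ; from-∈ = λ (_ , p) → tt , (tt , p)
    ; to-from = λ _ → refl ; from-to = λ _ → refl
    ; weight-to = λ {(_ , (_ , x))} _ → +-assoc a b (w x) })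
    (qpowEnum a ⊗ᴱ (qpowEnum b ⊗ᴱ E)) (qpowEnum (a + b) ⊗ᴱ E)

module _ {f g h : FPS} (F : Combinatorial f) (G : Combinatorial g) (H : Combinatorial h) where
  open Combinatorial F renaming (enumeration to E; size to w)
  open Combinatorial G renaming (enumeration to E′; size to v)
  open Combinatorial H renaming (enumeration to E″; size to u)

  ⊗-assoc : (f ⊗ g) ⊗ h ≗ f ⊗ (g ⊗ h)
  ⊗-assoc = bijection-≗ (record
    { to = λ ((x , y) , z) → x , (y , z) ; from = λ (x , (y , z)) → (x , y) , z
    ; to-∈ = λ ((p , q) , r) → p , (q , r) ; from-∈ = λ (p , (q , r)) → (p , q) , r
    ; to-from = λ _ → refl ; from-to = λ _ → refl
    ; weight-to = λ {((x , y) , z)} _ → sym (+-assoc (w x) (v y) (u z)) })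
    ((E ⊗ᴱ E′) ⊗ᴱ E″) (E ⊗ᴱ (E′ ⊗ᴱ E″))

qpow-+ : ∀ a b → qpow a ⊗ qpow b ≗ qpow (a + b)
qpow-+ a b = bijection-≗ (record
  { to = proj₁ ; from = λ _ → tt , tt ; to-∈ = proj₁ ; from-∈ = λ _ → tt , tt
  ; to-from = λ _ → refl ; from-to = λ _ → refl ; weight-to = λ _ → refl })
  (qpowEnum a ⊗ᴱ qpowEnum b) (qpowEnum (a + b))

Combinatorial-oneS : Combinatorial oneS
Combinatorial-oneS = combinatorial (Enumeration-resp-≗ (sym ∘ oneS≗qpow0) (qpowEnum 0))

Combinatorial-geomInv : ∀ a → Combinatorial (geomInv a)
Combinatorial-geomInv a = combinatorial (geomEnum a)

module _ {g : ℕ → FPS} (G : ∀ k → Combinatorial (g k)) where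

  Combinatorial-prodS : ∀ ks → Combinatorial (prodS (map g ks))
  Combinatorial-prodS []       = Combinatorial-oneS
  Combinatorial-prodS (k ∷ ks) = Combinatorial-⊗ (G k) (Combinatorial-prodS ks)

  prodS-∷ʳ : ∀ ks d → prodS (map g (ks ++ d ∷ [])) ≗ g d ⊗ prodS (map g ks)
  prodS-∷ʳ []       d n = refl
  prodS-∷ʳ (k ∷ ks) d n = begin
    (g k ⊗ prodS (map g (ks ++ d ∷ []))) n ≡⟨ ⊗-congˡ (g k) (prodS-∷ʳ ks d) n ⟩
    (g k ⊗ (g d ⊗ P)) n                    ≡⟨ ⊗-assoc (G k) (G d) (Combinatorial-prodS ks) n ⟨
    ((g k ⊗ g d) ⊗ P) n                    ≡⟨ ⊗-congʳ P (⊗-comm (G k) (G d)) n ⟩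
    ((g d ⊗ g k) ⊗ P) n                    ≡⟨ ⊗-assoc (G d) (G k) (Combinatorial-prodS ks) n ⟩
    (g d ⊗ (g k ⊗ P)) n                    ∎
    where
    open ≡-Reasoning
    P : FPS
    P = prodS (map g ks)

  prodS-upTo-suc : ∀ d → prodS (map g (upTo (suc d))) ≗ g d ⊗ prodS (map g (upTo d))
  prodS-upTo-suc d n = trans (cong (λ ks → prodS (map g ks) n) (sym (upTo-∷ʳ d))) (prodS-∷ʳ (upTo d) d n)

-- Runs

-- 1/(q^t;q^t)_d, built with its factor 1/(1 - q^{td}) in front
invPoch[_] : ℕ → ℕ → FPS
invPoch[ t ] zero    = oneS
invPoch[ t ] (suc d) = geomInv (t * suc d ∸ 1) ⊗ invPoch[ t ] d

-- weight of the multiplicities e₁, …, e_d of the parts t d, t (d - 1), …, t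
partWeight : ℕ → List ℕ → ℕ
partWeight t []       = 0
partWeight t (e ∷ es) = e * (t * suc (length es)) + partWeight t es

multiplicityEnum : ∀ t d → Enumeration (λ es → length es ≡ d) (partWeight (suc t)) (invPoch[ suc t ] d)
multiplicityEnum t zero    = transport (record
  { to = λ _ → [] ; from = λ _ → tt ; to-∈ = λ _ → refl ; from-∈ = λ _ → tt
  ; to-from = λ { {[]} _ → refl } ; from-to = λ _ → refl ; weight-to = λ _ → refl })
  (enumeration Combinatorial-oneS)
multiplicityEnum t (suc d) = transport (record
  { to = λ (e , es) → e ∷ es ; from = λ { [] → 0 , [] ; (e ∷ es) → e , es }
  ; to-∈ = λ (_ , len) → cong suc len ; from-∈ = λ { {_ ∷ _} len → tt , suc-injective len }
  ; to-from = λ { {_ ∷ _} _ → refl } ; from-to = λ _ → refl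
  ; weight-to = λ { {e , es} (_ , refl) → refl } })
  (geomEnum (suc t * suc d ∸ 1) ⊗ᴱ multiplicityEnum t d)

Combinatorial-invPoch[_] : ∀ t d → Combinatorial (invPoch[ suc t ] d)
Combinatorial-invPoch[ t ] d = combinatorial (multiplicityEnum t d)

invPoch≗invPoch[1] : ∀ d → invPoch d ≗ invPoch[ 1 ] d
invPoch≗invPoch[1] zero    n = refl
invPoch≗invPoch[1] (suc d) n = begin
  invPoch (suc d) n              ≡⟨ prodS-upTo-suc Combinatorial-geomInv d n ⟩
  (geomInv d ⊗ invPoch d) n      ≡⟨ ⊗-congˡ (geomInv d) (invPoch≗invPoch[1] d) n ⟩
  (geomInv d ⊗ invPoch[ 1 ] d) n ≡⟨ cong (λ a → (geomInv a ⊗ invPoch[ 1 ] d) n) (+-identityʳ d) ⟨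
  invPoch[ 1 ] (suc d) n         ∎
  where open ≡-Reasoning

invPoch2≗invPoch[2] : ∀ d → invPoch2 d ≗ invPoch[ 2 ] d
invPoch2≗invPoch[2] zero    n = refl
invPoch2≗invPoch[2] (suc d) n = begin
  invPoch2 (suc d) n                         ≡⟨ prodS-upTo-suc (Combinatorial-geomInv ∘ suc ∘ (2 *_)) d n ⟩
  (geomInv (suc (2 * d)) ⊗ invPoch2 d) n     ≡⟨ ⊗-congˡ (geomInv (suc (2 * d))) (invPoch2≗invPoch[2] d) n ⟩
  (geomInv (suc (2 * d)) ⊗ invPoch[ 2 ] d) n ≡⟨ cong (λ a → (geomInv a ⊗ invPoch[ 2 ] d) n) (+-suc d (d + 0)) ⟨
  invPoch[ 2 ] (suc d) n                     ∎
  where open ≡-Reasoning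

Chain : ℕ → ℕ → List ℕ → Set
Chain t c []      = ⊤
Chain t c (x ∷ B) = c ≤ x × t ∣ x ∸ c × Chain t x B

Run : ℕ → ℕ → ℕ → List ℕ → Set
Run t c d B = length B ≡ d × Chain t c B

-- runs whose increments are multiples of T = t + 1 (so that dividing by T is defined)
module _ (t : ℕ) where
  private
    T : ℕ
    T = suc t

  chainFrom : ℕ → List ℕ → List ℕ
  chainFrom c []       = []
  chainFrom c (e ∷ es) = c + T * e ∷ chainFrom (c + T * e) es

  gaps : ℕ → List ℕ → List ℕ
  gaps c []      = []
  gaps c (x ∷ B) = (x ∸ c) / T ∷ gaps x B

  length-chainFrom : ∀ c es → length (chainFrom c es) ≡ length es
  length-chainFrom c []       = refl
  length-chainFrom c (e ∷ es) = cong suc (length-chainFrom _ es)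

  length-gaps : ∀ c B → length (gaps c B) ≡ length B
  length-gaps c []      = refl
  length-gaps c (x ∷ B) = cong suc (length-gaps x B)

  chain-chainFrom : ∀ c es → Chain T c (chainFrom c es)
  chain-chainFrom c []       = tt
  chain-chainFrom c (e ∷ es) =
    m≤m+n c (T * e) , divides e (trans (m+n∸m≡n c (T * e)) (*-comm T e)) , chain-chainFrom _ es

  gaps-chainFrom : ∀ c es → gaps c (chainFrom c es) ≡ es
  gaps-chainFrom c []       = refl
  gaps-chainFrom c (e ∷ es) =
    cong₂ _∷_ (trans (cong (_/ T) (trans (m+n∸m≡n c (T * e)) (*-comm T e))) (m*n/n≡m e T))
              (gaps-chainFrom _ es)

  chainFrom-gaps : ∀ c B → Chain T c B → chainFrom c (gaps c B) ≡ B
  chainFrom-gaps c []      _                  = refl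
  chainFrom-gaps c (x ∷ B) (c≤x , T∣x∸c , ch) =
    cong₂ _∷_ next (trans (cong (λ y → chainFrom y (gaps x B)) next) (chainFrom-gaps x B ch))
    where
    next : c + T * ((x ∸ c) / T) ≡ x
    next = trans (cong (c +_) (trans (*-comm T _) (m/n*n≡m T∣x∸c))) (m+[n∸m]≡n c≤x)

  sum-chainFrom : ∀ c es → sum (chainFrom c es) ≡ c * length es + partWeight T es
  sum-chainFrom c []       = sym (trans (+-identityʳ _) (*-zeroʳ c))
  sum-chainFrom c (e ∷ es) =
    trans (cong (c + T * e +_) (sum-chainFrom (c + T * e) es)) (regroup c T e (length es) (partWeight T es))
    where
    regroup : ∀ c T e l w → (c + T * e) + ((c + T * e) * l + w) ≡ c * suc l + (e * (T * suc l) + w)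
    regroup = solve-∀

  runEnum : ∀ c d → Enumeration (Run T c d) sum (qpow (c * d) ⊗ invPoch[ T ] d)
  runEnum c d = transport (record
    { to        = λ (_ , es) → chainFrom c es
    ; from      = λ B → tt , gaps c B
    ; to-∈      = λ {(_ , es)} (_ , len) → trans (length-chainFrom c es) len , chain-chainFrom c es
    ; from-∈    = λ {B} (len , _) → tt , trans (length-gaps c B) len
    ; to-from   = λ {B} (_ , ch) → chainFrom-gaps c B ch
    ; from-to   = λ {(_ , es)} _ → cong (tt ,_) (gaps-chainFrom c es)
    ; weight-to = λ {(_ , es)} (_ , len) → trans (sum-chainFrom c es) (cong (λ l → c * l + partWeight T es) len)
    })
    (qpowEnum (c * d) ⊗ᴱ multiplicityEnum t d)

Ascending : List ℕ → Set
Ascending B = ∀ k → suc k < length B → at B k ≤ at B (suc k)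

HeadAtLeast : ℕ → List ℕ → Set
HeadAtLeast c B = 0 < length B → c ≤ at B 0

module _ {m : ℕ} .{{_ : NonZero m}} where

  ∣∸⇒%≡ : ∀ {c x} → c ≤ x → m ∣ x ∸ c → x % m ≡ c % m
  ∣∸⇒%≡ {c} c≤x (divides q x∸c≡q*m) =
    trans (cong (_% m) (trans (sym (m+[n∸m]≡n c≤x)) (cong (c +_) x∸c≡q*m))) ([m+kn]%n≡m%n c q m)

  %≡⇒∣∸ : ∀ {c x} → x % m ≡ c % m → m ∣ x ∸ c
  %≡⇒∣∸ {c} {x} x≡c = divides (x / m ∸ c / m) (begin
    x ∸ c                                     ≡⟨ cong₂ _∸_ (m≡m%n+[m/n]*n x m) (m≡m%n+[m/n]*n c m) ⟩
    (x % m + x / m * m) ∸ (c % m + c / m * m) ≡⟨ cong (λ y → (y + x / m * m) ∸ (c % m + c / m * m)) x≡c ⟩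
    (c % m + x / m * m) ∸ (c % m + c / m * m) ≡⟨ [m+n]∸[m+o]≡n∸o (c % m) _ _ ⟩
    x / m * m ∸ c / m * m                     ≡⟨ *-distribʳ-∸ m (x / m) (c / m) ⟨
    (x / m ∸ c / m) * m                       ∎)
    where open ≡-Reasoning

  AllCongruent : ℕ → List ℕ → Set
  AllCongruent c B = ∀ k → k < length B → at B k % m ≡ c % m

  Chain⇒ : ∀ {c} B → Chain m c B → Ascending B × HeadAtLeast c B × AllCongruent c B
  Chain⇒ []      _                  = (λ _ ()) , (λ ()) , (λ _ ())
  Chain⇒ (x ∷ B) (c≤x , m∣x∸c , ch) with asc , head , congr ← Chain⇒ B ch =
    ascending , (λ _ → c≤x) , congruent
    where
    ascending : Ascending (x ∷ B)
    ascending zero    (s≤s 0<len) = head 0<len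
    ascending (suc k) (s≤s k<len) = asc k k<len
    congruent : AllCongruent _ (x ∷ B)
    congruent zero    _           = ∣∸⇒%≡ c≤x m∣x∸c
    congruent (suc k) (s≤s k<len) = trans (congr k k<len) (∣∸⇒%≡ c≤x m∣x∸c)

  ⇒Chain : ∀ {c} B → Ascending B → HeadAtLeast c B → AllCongruent c B → Chain m c B
  ⇒Chain []      _   _    _     = tt
  ⇒Chain (x ∷ B) asc head congr =
    head (s≤s z≤n) , %≡⇒∣∸ (congr 0 (s≤s z≤n)) ,
    ⇒Chain B (λ k k<len → asc (suc k) (s≤s k<len)) (λ 0<len → asc 0 (s≤s 0<len))
             (λ k k<len → trans (congr (suc k) (s≤s k<len)) (sym (congr 0 (s≤s z≤n))))

Chain1⇔ : ∀ {c} B → Chain 1 c B ⇔ (Ascending B × HeadAtLeast c B)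
Chain1⇔ {c} B = mk⇔ (λ ch → let (asc , head , _) = Chain⇒ B ch in asc , head)
                    (λ (asc , head) → ⇒Chain B asc head (λ k _ → trans (n%1≡0 (at B k)) (sym (n%1≡0 c))))

%2-+2 : ∀ n → (2 + n) % 2 ≡ n % 2
%2-+2 n = trans (cong (_% 2) (+-comm 2 n)) ([m+kn]%n≡m%n n 1 2)

%2-suc-cong : ∀ {a b} → a % 2 ≡ b % 2 → suc a % 2 ≡ suc b % 2
%2-suc-cong {a} {b} a≡b =
  trans (%-distribˡ-+ 1 a 2) (trans (cong (λ z → (1 % 2 + z) % 2) a≡b) (sym (%-distribˡ-+ 1 b 2)))

%2-suc-≢ : ∀ n → n % 2 ≢ suc n % 2
%2-suc-≢ zero          ()
%2-suc-≢ (suc zero)    ()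
%2-suc-≢ (suc (suc n)) eq = %2-suc-≢ n (trans (sym (%2-+2 n)) (trans eq (%2-+2 (suc n))))

%2-reflect : ∀ {R I} → I ≤ R → (R + (R ∸ I)) % 2 ≡ I % 2
%2-reflect {R} {I} I≤R with d , refl ← m≤n⇒∃[o]m+o≡n I≤R = begin
  (I + d + (I + d ∸ I)) % 2 ≡⟨ cong (λ z → (I + d + z) % 2) (m+n∸m≡n I d) ⟩
  (I + d + d) % 2           ≡⟨ cong (_% 2) (+-assoc I d d) ⟩
  (I + (d + d)) % 2         ≡⟨ cong (λ z → (I + z) % 2) (trans (cong (d +_) (sym (+-identityʳ d))) (*-comm 2 d)) ⟩
  (I + d * 2) % 2           ≡⟨ [m+kn]%n≡m%n I d 2 ⟩
  I % 2                     ∎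
  where open ≡-Reasoning

%2-∸2 : ∀ {M a} → 2 + a ≤ M → (M ∸ a) % 2 ≡ (M ∸ (2 + a)) % 2
%2-∸2 {suc (suc M)} {a} (s≤s (s≤s a≤M)) = trans (cong (_% 2) (+-∸-assoc 2 a≤M)) (%2-+2 (M ∸ a))

record ParityFloor (c p c′ : ℕ) : Set where
  field
    floor : ∀ z → (c ≤ z × z % 2 ≡ p % 2) ⇔ (c′ ≤ z × z % 2 ≡ c′ % 2)

ParityFloor-+0 : ∀ {c p} → c % 2 ≡ p % 2 → ParityFloor c p (c + 0)
ParityFloor-+0 {c} c≡p .ParityFloor.floor z rewrite +-identityʳ c =
  mk⇔ (λ (c≤z , z≡p) → c≤z , trans z≡p (sym c≡p)) (λ (c≤z , z≡c) → c≤z , trans z≡c c≡p)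

ParityFloor-+1 : ∀ {c p} → suc c % 2 ≡ p % 2 → ParityFloor c p (c + 1)
ParityFloor-+1 {c} 1+c≡p .ParityFloor.floor z rewrite +-comm c 1 = mk⇔
  (λ (c≤z , z≡p) → c<z c≤z (trans z≡p (sym 1+c≡p)) , trans z≡p (sym 1+c≡p))
  (λ (c<z , z≡1+c) → <⇒≤ c<z , trans z≡1+c 1+c≡p)
  where
  c<z : ∀ {z} → c ≤ z → z % 2 ≡ suc c % 2 → c < z
  c<z c≤z z≡1+c with m≤n⇒m<n∨m≡n c≤z
  ... | inj₁ c<z  = c<z
  ... | inj₂ refl = ⊥-elim (%2-suc-≢ c z≡1+c)

module _ {c p c′ : ℕ} (pf : ParityFloor c p c′) where
  open Equivalence
  open ParityFloor pf

  lastRun⇒ : ∀ B → Ascending B → HeadAtLeast c B → AllCongruent {2} p B → Chain 2 c′ B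
  lastRun⇒ []          _   _    _     = tt
  lastRun⇒ B@(x ∷ _) asc head congr
    with c′≤x , x≡c′ ← to (floor x) (head (s≤s z≤n) , congr 0 (s≤s z≤n)) =
    ⇒Chain B asc (λ _ → c′≤x) (λ k k<len → trans (congr k k<len) (trans (sym (congr 0 (s≤s z≤n))) x≡c′))

  lastRun⇐ : ∀ B → Chain 2 c′ B → Ascending B × HeadAtLeast c B × AllCongruent {2} p B
  lastRun⇐ []          _  = (λ _ ()) , (λ ()) , (λ _ ())
  lastRun⇐ B@(x ∷ _) ch
    with asc , head , congr ← Chain⇒ B ch
    with c≤x , x≡p ← from (floor x) (head (s≤s z≤n) , congr 0 (s≤s z≤n)) =
    asc , (λ _ → c≤x) , (λ k k<len → trans (congr k k<len) (trans (sym (congr 0 (s≤s z≤n))) x≡p))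

NonIncreasing : List ℕ → Set
NonIncreasing []      = ⊤
NonIncreasing (x ∷ s) = at s 0 ≤ x × NonIncreasing s

at≤head : ∀ {s} → NonIncreasing s → ∀ j → at s j ≤ at s 0
at≤head {[]}    _          j       = z≤n
at≤head {x ∷ s} _          zero    = ≤-refl
at≤head {x ∷ s} (y≤x , ni) (suc j) = ≤-trans (at≤head ni j) y≤x

at-++ˡ : ∀ xs ys {k} → k < length xs → at (xs ++ ys) k ≡ at xs k
at-++ˡ (x ∷ xs) ys {zero}  _        = refl
at-++ˡ (x ∷ xs) ys {suc k} (s≤s k<) = at-++ˡ xs ys k<

at-++ʳ : ∀ xs ys k → at (xs ++ ys) (length xs + k) ≡ at ys k
at-++ʳ []       ys k = refl
at-++ʳ (x ∷ xs) ys k = at-++ʳ xs ys k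

-- λ = l′ ++ B over x ∷ s′: B is the top run λ_{s_2}, …, λ_{s_1 - 1} and l′ the part over s′
module RunSplit (x : ℕ) (s′ : List ℕ) (ni : NonIncreasing (x ∷ s′)) (l′ B : List ℕ)
                (len-l′ : length l′ ≡ at s′ 0) (len-B : length B ≡ x ∸ at s′ 0) where

  private
    y r′ : ℕ
    y  = at s′ 0
    r′ = length s′

    below : ∀ {j k} → k < at s′ j → at (l′ ++ B) k ≡ at l′ k
    below {j} k< = at-++ˡ l′ B (subst (_ <_) (sym len-l′) (<-≤-trans k< (at≤head (proj₂ ni) j)))

    above : ∀ k → at (l′ ++ B) (y + k) ≡ at B k
    above k = trans (cong (λ z → at (l′ ++ B) (z + k)) (sym len-l′)) (at-++ʳ l′ B k)

    above-0 : at (l′ ++ B) y ≡ at B 0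
    above-0 = trans (cong (at (l′ ++ B)) (sym (+-identityʳ y))) (above 0)

    above-suc : ∀ k → at (l′ ++ B) (suc (y + k)) ≡ at B (suc k)
    above-suc k = trans (cong (at (l′ ++ B)) (sym (+-suc y k))) (above (suc k))

    in-B : ∀ {k} → suc (y + k) < x ⇔ suc k < length B
    in-B {k} = mk⇔
      (λ lt → subst (suc k <_) (sym len-B)
                (m+n≤o⇒m≤o∸n (suc (suc k)) (subst (_≤ x) (cong (suc ∘ suc) (+-comm y k)) lt)))
      (λ lt → subst (_≤ x) (cong (suc ∘ suc) (+-comm k y))
                (m≤o∸n⇒m+n≤o (suc (suc k)) (proj₁ ni) (subst (suc k <_) len-B lt)))

    nonempty-B : y < x ⇔ 0 < length B
    nonempty-B = mk⇔ (λ y<x → subst (0 <_) (sym len-B) (m<n⇒0<n∸m y<x))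
                     (λ 0<len → m∸n≢0⇒n<m (λ eq → <-irrefl (sym (trans len-B eq)) 0<len))

  open Equivalence

  InP-++ : InP (suc (suc r′)) (x ∷ s′) (l′ ++ B) ⇔ (InP (suc r′) s′ l′ × Ascending B)
  InP-++ = mk⇔ (λ inP → inP⇒ˡ inP , inP⇒ʳ inP) (λ (inPˡ , asc) → ⇒inP inPˡ asc)
    where
    inP⇒ˡ : InP (suc (suc r′)) (x ∷ s′) (l′ ++ B) → InP (suc r′) s′ l′
    inP⇒ˡ (_ , asc) = len-l′ , λ { (suc j) _ j≤ k lo hi →
      subst₂ _≤_ (below {j} (<-trans (n<1+n k) hi)) (below {j} hi)
                 (asc (suc (suc j)) (s≤s z≤n) (s≤s j≤) k lo hi) }
    inP⇒ʳ : InP (suc (suc r′)) (x ∷ s′) (l′ ++ B) → Ascending B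
    inP⇒ʳ (_ , asc) k k< = subst₂ _≤_ (above k) (above-suc k)
      (asc 1 (s≤s z≤n) (s≤s z≤n) (y + k) (m≤m+n y k) (from in-B k<))
    ⇒inP : InP (suc r′) s′ l′ → Ascending B → InP (suc (suc r′)) (x ∷ s′) (l′ ++ B)
    ⇒inP (_ , ascˡ) ascʳ =
      trans (length-++ l′) (trans (cong₂ _+_ len-l′ len-B) (m+[n∸m]≡n (proj₁ ni))) , asc
      where
      asc : ∀ j → 1 ≤ j → j ≤ suc r′ → ∀ k → sj (x ∷ s′) (suc j) ≤ k → suc k < sj (x ∷ s′) j →
            at (l′ ++ B) k ≤ at (l′ ++ B) (suc k)
      asc (suc zero) _ _ k y≤k k<x with k′ , refl ← m≤n⇒∃[o]m+o≡n y≤k =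
        subst₂ _≤_ (sym (above k′)) (sym (above-suc k′)) (ascʳ k′ (to in-B k<x))
      asc (suc (suc j)) _ (s≤s j≤) k lo hi =
        subst₂ _≤_ (sym (below {j} (<-trans (n<1+n k) hi))) (sym (below {j} hi))
                   (ascˡ (suc j) (s≤s z≤n) j≤ k lo hi)

  LowerB-++ : ∀ b → LowerB (suc (suc r′)) b (x ∷ s′) (l′ ++ B) ⇔
                    (LowerB (suc r′) (b ∘ suc) s′ l′ × HeadAtLeast (b 1) B)
  LowerB-++ b = mk⇔
    (λ low → (λ { (suc j) _ j≤ lt → subst (b (suc (suc j)) ≤_) (below {j} lt)
                                          (low (suc (suc j)) (s≤s z≤n) (s≤s j≤) lt) }) ,
             (λ 0<len → subst (b 1 ≤_) above-0 (low 1 (s≤s z≤n) (s≤s z≤n) (from nonempty-B 0<len))))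
    (λ (lowˡ , head) → λ
      { (suc zero) _ _ y<x → subst (b 1 ≤_) (sym above-0) (head (to nonempty-B y<x))
      ; (suc (suc j)) _ (s≤s j≤) lt →
          subst (b (suc (suc j)) ≤_) (sym (below {j} lt)) (lowˡ (suc j) (s≤s z≤n) j≤ lt) })

Parity-++ : ∀ p x x₂ s l′ B → NonIncreasing (x₂ ∷ s) → length l′ ≡ x₂ →
            Parity (suc (suc (length (x₂ ∷ s)))) p (x ∷ x₂ ∷ s) (l′ ++ B) ⇔
            Parity (suc (length (x₂ ∷ s))) p (x₂ ∷ s) l′
Parity-++ p x x₂ s l′ B ni len-l′ = mk⇔
  (λ par k k< → subst (λ z → z % 2 ≡ p % 2) (below k<) (par k k<))
  (λ par k k< → subst (λ z → z % 2 ≡ p % 2) (sym (below k<)) (par k k<))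
  where
  below : ∀ {k} → k < at (x₂ ∷ s) (length s) → at (l′ ++ B) k ≡ at l′ k
  below k< = at-++ˡ l′ B (subst (_ <_) (sym len-l′) (<-≤-trans k< (at≤head ni (length s))))

LowerFibre : (ℕ → ℕ) → List ℕ → List ℕ → Set
LowerFibre b s l = InP (suc (length s)) s l × LowerB (suc (length s)) b s l

ParityFibre : (ℕ → ℕ) → ℕ → List ℕ → List ℕ → Set
ParityFibre b p s l = LowerFibre b s l × Parity (suc (length s)) p s l

-- Σ_j b_j (s_j - s_{j+1}), the least |λ| in the fibre
minWeight : (ℕ → ℕ) → List ℕ → ℕ
minWeight b []      = 0
minWeight b (x ∷ s) = b 1 * (x ∸ at s 0) + minWeight (b ∘ suc) s

take-length-++ : ∀ {A : Set} (xs ys : List A) → take (length xs) (xs ++ ys) ≡ xs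
take-length-++ []       ys = refl
take-length-++ (x ∷ xs) ys = cong (x ∷_) (take-length-++ xs ys)

drop-length-++ : ∀ {A : Set} (xs ys : List A) → drop (length xs) (xs ++ ys) ≡ ys
drop-length-++ []       ys = refl
drop-length-++ (x ∷ xs) ys = drop-length-++ xs ys

module _ {H G F : List ℕ → Set} (y : ℕ) (G⇒length : ∀ {l} → G l → length l ≡ y)
         (join : ∀ B l′ → H B → G l′ → F (l′ ++ B))
         (split : ∀ {l} → F l → H (drop y l) × G (take y l)) where

  ++-Enumeration : ∀ {h g} → Enumeration H sum h → Enumeration G sum g → Enumeration F sum (h ⊗ g)
  ++-Enumeration E E′ = transport (record
    { to        = λ (B , l′) → l′ ++ B
    ; from      = λ l → drop y l , take y l
    ; to-∈      = λ {(B , l′)} (hB , gl′) → join B l′ hB gl′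
    ; from-∈    = split
    ; to-from   = λ {l} _ → take++drop≡id y l
    ; from-to   = λ {(B , l′)} (_ , gl′) → subst (λ k → (drop k (l′ ++ B) , take k (l′ ++ B)) ≡ (B , l′))
                    (G⇒length gl′) (cong₂ _,_ (drop-length-++ l′ B) (take-length-++ l′ B))
    ; weight-to = λ {(B , l′)} _ → trans (sum-++ l′ B) (+-comm (sum l′) (sum B))
    })
    (E ⊗ᴱ E′)

module _ (b : ℕ → ℕ) (x : ℕ) (s′ : List ℕ) (ni : NonIncreasing (x ∷ s′)) where
  private
    y : ℕ
    y = at s′ 0
  open Equivalence

  LowerFibre-join : ∀ B l′ → Run 1 (b 1) (x ∸ y) B → LowerFibre (b ∘ suc) s′ l′ →
                    LowerFibre b (x ∷ s′) (l′ ++ B)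
  LowerFibre-join B l′ (len-B , ch) (inPˡ , lowˡ) with asc , head ← to (Chain1⇔ B) ch =
    from InP-++ (inPˡ , asc) , from (LowerB-++ b) (lowˡ , head)
    where open RunSplit x s′ ni l′ B (proj₁ inPˡ) len-B

  LowerFibre-length : ∀ {l} → LowerFibre b (x ∷ s′) l → length (take y l) ≡ y × length (drop y l) ≡ x ∸ y
  LowerFibre-length {l} ((len , _) , _) =
    trans (length-take y l) (m≤n⇒m⊓n≡m (subst (y ≤_) (sym len) (proj₁ ni))) ,
    trans (length-drop y l) (cong (_∸ y) len)

  LowerFibre-split : ∀ {l} → LowerFibre b (x ∷ s′) l →
                     Run 1 (b 1) (x ∸ y) (drop y l) × LowerFibre (b ∘ suc) s′ (take y l)
  LowerFibre-split {l} fib@(inP , low)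
    with len-l′ , len-B ← LowerFibre-length fib
    with inPˡ , asc ← to (RunSplit.InP-++ x s′ ni (take y l) (drop y l) len-l′ len-B)
                         (subst (InP (suc (length (x ∷ s′))) (x ∷ s′)) (sym (take++drop≡id y l)) inP)
    with lowˡ , head ← to (RunSplit.LowerB-++ x s′ ni (take y l) (drop y l) len-l′ len-B b)
                          (subst (LowerB (suc (length (x ∷ s′))) b (x ∷ s′)) (sym (take++drop≡id y l)) low) =
    (len-B , from (Chain1⇔ (drop y l)) (asc , head)) , (inPˡ , lowˡ)

Combinatorial-invPoch : ∀ d → Combinatorial (invPoch d)
Combinatorial-invPoch d = Combinatorial-prodS Combinatorial-geomInv (upTo d)

Combinatorial-invPoch2 : ∀ d → Combinatorial (invPoch2 d)
Combinatorial-invPoch2 d = Combinatorial-prodS (Combinatorial-geomInv ∘ suc ∘ (2 *_)) (upTo d)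

invPochFactor : List ℕ → ℕ → FPS
invPochFactor s k = invPoch (sj s (suc k) ∸ sj s (suc (suc k)))

Combinatorial-invPochFactors : ∀ s m → Combinatorial (prodS (map (invPochFactor s) (upTo m)))
Combinatorial-invPochFactors s m =
  Combinatorial-prodS {g = invPochFactor s} (λ k → Combinatorial-invPoch (sj s (suc k) ∸ sj s (suc (suc k)))) (upTo m)

Combinatorial-invD1 : ∀ r s → Combinatorial (invD1 r s)
Combinatorial-invD1 r s = Combinatorial-invPochFactors s (r ∸ 1)

Combinatorial-invD2 : ∀ r s → Combinatorial (invD2 r s)
Combinatorial-invD2 r s =
  Combinatorial-⊗ (Combinatorial-invPochFactors s (r ∸ 2)) (Combinatorial-invPoch2 (sj s (r ∸ 1)))

prodS-invPoch-∷ : ∀ x s m → prodS (map (invPochFactor (x ∷ s)) (upTo (suc m))) ≡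
                             invPoch (x ∸ at s 0) ⊗ prodS (map (invPochFactor s) (upTo m))
prodS-invPoch-∷ x s m = cong (λ fs → invPoch (x ∸ at s 0) ⊗ prodS fs)
  (trans (map-applyUpTo suc (invPochFactor (x ∷ s)) m) (sym (map-applyUpTo id (invPochFactor s) m)))

invD1-∷ : ∀ x s → invD1 (suc (length (x ∷ s))) (x ∷ s) ≡ invPoch (x ∸ at s 0) ⊗ invD1 (suc (length s)) s
invD1-∷ x s = prodS-invPoch-∷ x s (length s)

invD2-∷ : ∀ x x₂ s → invD2 (suc (length (x ∷ x₂ ∷ s))) (x ∷ x₂ ∷ s) ≗
                     invPoch (x ∸ x₂) ⊗ invD2 (suc (length (x₂ ∷ s))) (x₂ ∷ s)
invD2-∷ x x₂ s n = trans
  (cong (λ f → (f ⊗ invPoch2 (at (x₂ ∷ s) (length s))) n) (prodS-invPoch-∷ x (x₂ ∷ s) (length s)))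
  (⊗-assoc (Combinatorial-invPoch (x ∸ x₂)) (Combinatorial-invPochFactors (x₂ ∷ s) (length s))
           (Combinatorial-invPoch2 (at (x₂ ∷ s) (length s))) n)

step-series : ∀ a k d {D} → Combinatorial D →
              (qpow a ⊗ invPoch[ 1 ] d) ⊗ (qpow k ⊗ D) ≗ qpow (a + k) ⊗ (invPoch d ⊗ D)
step-series a k d {D} 𝔇 n = trans
  (qpow-⊗-interchange (Combinatorial-invPoch[ 0 ] d) 𝔇 a k n)
  (⊗-congˡ (qpow (a + k)) (⊗-congʳ D (sym ∘ invPoch≗invPoch[1] d)) n)

lowerFibreEnum : ∀ b s → NonIncreasing s →
                 Enumeration (LowerFibre b s) sum (qpow (minWeight b s) ⊗ invD1 (suc (length s)) s)
lowerFibreEnum b [] _ = transport (record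
  { to = λ _ → [] ; from = λ _ → tt , tt
  ; to-∈ = λ _ → (refl , λ { (suc _) _ () }) , λ { (suc _) _ () }
  ; from-∈ = λ _ → tt , tt
  ; to-from = λ { {[]} _ → refl } ; from-to = λ _ → refl ; weight-to = λ _ → refl })
  (qpowEnum 0 ⊗ᴱ enumeration Combinatorial-oneS)
lowerFibreEnum b (x ∷ s′) ni@(_ , ni′) =
  Enumeration-resp-≗ series
    (++-Enumeration {Run 1 (b 1) (x ∸ at s′ 0)} {LowerFibre (b ∘ suc) s′} {LowerFibre b (x ∷ s′)}
      (at s′ 0) (proj₁ ∘ proj₁) (LowerFibre-join b x s′ ni) (LowerFibre-split b x s′ ni)
      (runEnum 0 (b 1) (x ∸ at s′ 0)) (lowerFibreEnum (b ∘ suc) s′ ni′))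
  where
  series : (qpow (b 1 * (x ∸ at s′ 0)) ⊗ invPoch[ 1 ] (x ∸ at s′ 0)) ⊗
           (qpow (minWeight (b ∘ suc) s′) ⊗ invD1 (suc (length s′)) s′) ≗
           qpow (minWeight b (x ∷ s′)) ⊗ invD1 (suc (length (x ∷ s′))) (x ∷ s′)
  series n = trans (step-series (b 1 * (x ∸ at s′ 0)) (minWeight (b ∘ suc) s′) (x ∸ at s′ 0)
                                (Combinatorial-invD1 (suc (length s′)) s′) n)
                   (cong (λ f → (qpow (minWeight b (x ∷ s′)) ⊗ f) n) (sym (invD1-∷ x s′)))

-- The lowest run is the one constrained by parity; raising its bound by e (0 or 1) to the
-- parity p turns it into a run of step 2.
lowestRunEnum : ∀ b p e x → ParityFloor (b 1) p (b 1 + e) →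
                Enumeration (ParityFibre b p (x ∷ [])) sum
                            (qpow (minWeight b (x ∷ []) + e * x) ⊗ invD2 2 (x ∷ []))
lowestRunEnum b p e x floor =
  Enumeration-resp-≗ series (transport (reweigh run⇒fibre fibre⇒run (λ _ → refl)) (runEnum 1 (b 1 + e) x))
  where
  open Equivalence
  run⇒fibre : ∀ {l} → Run 2 (b 1 + e) x l → ParityFibre b p (x ∷ []) l
  run⇒fibre {l} (len , ch) with asc , head , congr ← lastRun⇐ floor l ch =
    (from InP-++ ((refl , λ { (suc _) _ () }) , asc) , from (LowerB-++ b) ((λ { (suc _) _ () }) , head)) ,
    (λ k k<x → congr k (subst (k <_) (sym len) k<x))
    where open RunSplit x [] (z≤n , tt) [] l refl len
  fibre⇒run : ∀ {l} → ParityFibre b p (x ∷ []) l → Run 2 (b 1 + e) x l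
  fibre⇒run {l} ((inP@(len , _) , low) , par) =
    len , lastRun⇒ floor l (proj₂ (to InP-++ inP)) (proj₂ (to (LowerB-++ b) low))
                           (λ k k< → par k (subst (k <_) len k<))
    where open RunSplit x [] (z≤n , tt) [] l refl len
  series : qpow ((b 1 + e) * x) ⊗ invPoch[ 2 ] x ≗ qpow (b 1 * x + 0 + e * x) ⊗ (oneS ⊗ invPoch2 x)
  series n = trans
    (cong (λ a → (qpow a ⊗ invPoch[ 2 ] x) n)
          (trans (*-distribʳ-+ x (b 1) e) (cong (_+ e * x) (sym (+-identityʳ (b 1 * x))))))
    (⊗-congˡ (qpow (b 1 * x + 0 + e * x))
       (λ m → sym (trans (⊗-identityˡ (Combinatorial-invPoch2 x) m) (invPoch2≗invPoch[2] x m))) n)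

parityFibreEnum : ∀ b p e x s → NonIncreasing (x ∷ s) →
                  ParityFloor (b (length (x ∷ s))) p (b (length (x ∷ s)) + e) →
                  Enumeration (ParityFibre b p (x ∷ s)) sum
                    (qpow (minWeight b (x ∷ s) + e * sj (x ∷ s) (length (x ∷ s))) ⊗
                     invD2 (suc (length (x ∷ s))) (x ∷ s))
parityFibreEnum b p e x []       _             floor = lowestRunEnum b p e x floor
parityFibreEnum b p e x (x₂ ∷ s) ni@(_ , ni′) floor =
  Enumeration-resp-≗ series
    (++-Enumeration {Run 1 (b 1) (x ∸ x₂)} {ParityFibre (b ∘ suc) p (x₂ ∷ s)} {ParityFibre b p (x ∷ x₂ ∷ s)}
      x₂ (proj₁ ∘ proj₁ ∘ proj₁) join split
      (runEnum 0 (b 1) (x ∸ x₂)) (parityFibreEnum (b ∘ suc) p e x₂ s ni′ floor))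
  where
  open Equivalence
  last : ℕ
  last = at (x₂ ∷ s) (length s)
  join : ∀ B l′ → Run 1 (b 1) (x ∸ x₂) B → ParityFibre (b ∘ suc) p (x₂ ∷ s) l′ →
         ParityFibre b p (x ∷ x₂ ∷ s) (l′ ++ B)
  join B l′ run (fib , par) =
    LowerFibre-join b x (x₂ ∷ s) ni B l′ run fib ,
    from (Parity-++ p x x₂ s l′ B ni′ (proj₁ (proj₁ fib))) par
  split : ∀ {l} → ParityFibre b p (x ∷ x₂ ∷ s) l →
          Run 1 (b 1) (x ∸ x₂) (drop x₂ l) × ParityFibre (b ∘ suc) p (x₂ ∷ s) (take x₂ l)
  split {l} (fib , par) with run , fibˡ ← LowerFibre-split b x (x₂ ∷ s) ni fib =
    run , fibˡ ,
    to (Parity-++ p x x₂ s (take x₂ l) (drop x₂ l) ni′ (proj₁ (LowerFibre-length b x (x₂ ∷ s) ni fib)))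
       (subst (Parity (suc (length (x ∷ x₂ ∷ s))) p (x ∷ x₂ ∷ s)) (sym (take++drop≡id x₂ l)) par)
  series : (qpow (b 1 * (x ∸ x₂)) ⊗ invPoch[ 1 ] (x ∸ x₂)) ⊗
           (qpow (minWeight (b ∘ suc) (x₂ ∷ s) + e * last) ⊗ invD2 (suc (length (x₂ ∷ s))) (x₂ ∷ s)) ≗
           qpow (minWeight b (x ∷ x₂ ∷ s) + e * last) ⊗ invD2 (suc (length (x ∷ x₂ ∷ s))) (x ∷ x₂ ∷ s)
  series n = begin
    _ ≡⟨ step-series (b 1 * (x ∸ x₂)) (minWeight (b ∘ suc) (x₂ ∷ s) + e * last) (x ∸ x₂)
                     (Combinatorial-invD2 (suc (length (x₂ ∷ s))) (x₂ ∷ s)) n ⟩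
    (qpow (b 1 * (x ∸ x₂) + (minWeight (b ∘ suc) (x₂ ∷ s) + e * last)) ⊗ (invPoch (x ∸ x₂) ⊗ D)) n
      ≡⟨ cong (λ a → (qpow a ⊗ (invPoch (x ∸ x₂) ⊗ D)) n)
              (sym (+-assoc (b 1 * (x ∸ x₂)) (minWeight (b ∘ suc) (x₂ ∷ s)) (e * last))) ⟩
    (qpow (minWeight b (x ∷ x₂ ∷ s) + e * last) ⊗ (invPoch (x ∸ x₂) ⊗ D)) n
      ≡⟨ ⊗-congˡ (qpow (minWeight b (x ∷ x₂ ∷ s) + e * last)) (sym ∘ invD2-∷ x x₂ s) n ⟩
    _ ∎
    where
    open ≡-Reasoning
    D : FPS
    D = invD2 (suc (length (x₂ ∷ s))) (x₂ ∷ s)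

-- The weight of μ(s)

sumBelow : ℕ → (ℕ → ℕ) → ℕ
sumBelow n g = sum (map g (upTo n))

sumBelow-suc : ∀ n g → sumBelow (suc n) g ≡ sumBelow n g + g n
sumBelow-suc n g = begin
  sum (map g (upTo (suc n)))         ≡⟨ cong (sum ∘ map g) (upTo-∷ʳ n) ⟨
  sum (map g (upTo n ++ n ∷ []))     ≡⟨ cong sum (map-++ g (upTo n) (n ∷ [])) ⟩
  sum (map g (upTo n) ++ g n ∷ [])   ≡⟨ sum-++ (map g (upTo n)) (g n ∷ []) ⟩
  sumBelow n g + (g n + 0)           ≡⟨ cong (sumBelow n g +_) (+-identityʳ (g n)) ⟩
  sumBelow n g + g n                 ∎
  where open ≡-Reasoning

sumBelow-sucˡ : ∀ n g → sumBelow (suc n) g ≡ g 0 + sumBelow n (g ∘ suc)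
sumBelow-sucˡ n g = cong (λ gs → g 0 + sum gs) (trans (map-applyUpTo suc g n) (sym (map-applyUpTo id (g ∘ suc) n)))

sumBelow-cong : ∀ n {g h} → (∀ {k} → k < n → g k ≡ h k) → sumBelow n g ≡ sumBelow n h
sumBelow-cong zero    eq = refl
sumBelow-cong (suc n) {g} {h} eq = begin
  sumBelow (suc n) g  ≡⟨ sumBelow-suc n g ⟩
  sumBelow n g + g n  ≡⟨ cong₂ _+_ (sumBelow-cong n (eq ∘ m<n⇒m<1+n)) (eq ≤-refl) ⟩
  sumBelow n h + h n  ≡⟨ sumBelow-suc n h ⟨
  sumBelow (suc n) h  ∎
  where open ≡-Reasoning

sumBelow-+ : ∀ n g h → sumBelow n (λ k → g k + h k) ≡ sumBelow n g + sumBelow n h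
sumBelow-+ zero    g h = refl
sumBelow-+ (suc n) g h = begin
  sumBelow (suc n) (λ k → g k + h k)               ≡⟨ sumBelow-sucˡ n _ ⟩
  (g 0 + h 0) + sumBelow n (λ k → g (suc k) + h (suc k))
    ≡⟨ cong ((g 0 + h 0) +_) (sumBelow-+ n (g ∘ suc) (h ∘ suc)) ⟩
  (g 0 + h 0) + (sumBelow n (g ∘ suc) + sumBelow n (h ∘ suc)) ≡⟨ interchange (g 0) (h 0) _ _ ⟩
  (g 0 + sumBelow n (g ∘ suc)) + (h 0 + sumBelow n (h ∘ suc))
    ≡⟨ cong₂ _+_ (sumBelow-sucˡ n g) (sumBelow-sucˡ n h) ⟨
  sumBelow (suc n) g + sumBelow (suc n) h          ∎
  where open ≡-Reasoning

sumBelow-double : ∀ n g → sumBelow (2 * n) g ≡ sumBelow n (λ u → g (2 * u) + g (suc (2 * u)))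
sumBelow-double zero    g = refl
sumBelow-double (suc n) g = begin
  sumBelow (2 * suc n) g                               ≡⟨ cong (λ m → sumBelow m g) (+-suc (suc n) (n + 0)) ⟩
  sumBelow (suc (suc (2 * n))) g                       ≡⟨ sumBelow-suc (suc (2 * n)) g ⟩
  sumBelow (suc (2 * n)) g + g (suc (2 * n))           ≡⟨ cong (_+ g (suc (2 * n))) (sumBelow-suc (2 * n) g) ⟩
  sumBelow (2 * n) g + g (2 * n) + g (suc (2 * n))     ≡⟨ +-assoc (sumBelow (2 * n) g) _ _ ⟩
  sumBelow (2 * n) g + (g (2 * n) + g (suc (2 * n)))
    ≡⟨ cong (_+ (g (2 * n) + g (suc (2 * n)))) (sumBelow-double n g) ⟩
  sumBelow n _ + (g (2 * n) + g (suc (2 * n)))         ≡⟨ sumBelow-suc n _ ⟨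
  sumBelow (suc n) (λ u → g (2 * u) + g (suc (2 * u))) ∎
  where open ≡-Reasoning

sumBelow-0 : ∀ n {g} → (∀ k → g k ≡ 0) → sumBelow n g ≡ 0
sumBelow-0 zero    _  = refl
sumBelow-0 (suc n) g≡0 = trans (sumBelow-sucˡ n _) (cong₂ _+_ (g≡0 0) (sumBelow-0 n (g≡0 ∘ suc)))

sumBelow-2* : ∀ x → sumBelow x (2 *_) ≡ x * (x ∸ 1)
sumBelow-2* zero    = refl
sumBelow-2* (suc x) = trans (sumBelow-suc x (2 *_)) (trans (cong (_+ 2 * x) (sumBelow-2* x)) (step x))
  where
  step : ∀ x → x * (x ∸ 1) + 2 * x ≡ suc x * x
  step zero    = refl
  step (suc y) = ring y
    where
    ring : ∀ y → suc y * y + 2 * suc y ≡ suc (suc y) * suc y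
    ring = solve-∀

𝟙[_<_] : ℕ → ℕ → ℕ
𝟙[ u < x ] with u <? x
... | yes _ = 1
... | no  _ = 0

𝟙-yes : ∀ {u x} → u < x → 𝟙[ u < x ] ≡ 1
𝟙-yes {u} {x} u<x with u <? x
... | yes _   = refl
... | no  u≮x = ⊥-elim (u≮x u<x)

𝟙-no : ∀ {u x} → ¬ u < x → 𝟙[ u < x ] ≡ 0
𝟙-no {u} {x} u≮x with u <? x
... | yes u<x = ⊥-elim (u≮x u<x)
... | no  _   = refl

inRange-yes : ∀ {a b u} → a ≤ u → u < b → inRange a b u ≡ 1
inRange-yes {a} {b} {u} a≤u u<b with suc u ≤? b | a ≤? u
... | yes _   | yes _   = refl
... | no  u≮b | _       = ⊥-elim (u≮b u<b)
... | yes _   | no  a≰u = ⊥-elim (a≰u a≤u)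

inRange-no : ∀ {a b u} → ¬ (a ≤ u × u < b) → inRange a b u ≡ 0
inRange-no {a} {b} {u} ∉ with suc u ≤? b | a ≤? u
... | yes u<b | yes a≤u = ⊥-elim (∉ (a≤u , u<b))
... | no  _   | _       = refl
... | yes _   | no  _   = refl

inRange+𝟙 : ∀ {a b} u → a ≤ b → inRange a b u + 𝟙[ u < a ] ≡ 𝟙[ u < b ]
inRange+𝟙 {a} {b} u a≤b = by-cases (u <? a) (u <? b)
  where
  by-cases : Dec (u < a) → Dec (u < b) → inRange a b u + 𝟙[ u < a ] ≡ 𝟙[ u < b ]
  by-cases (yes u<a) _         = trans (cong₂ _+_ (inRange-no (λ (a≤u , _) → <⇒≱ u<a a≤u)) (𝟙-yes u<a))
                                       (sym (𝟙-yes (<-≤-trans u<a a≤b)))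
  by-cases (no  u≮a) (yes u<b) = trans (cong₂ _+_ (inRange-yes (≮⇒≥ u≮a) u<b) (𝟙-no u≮a))
                                       (sym (𝟙-yes u<b))
  by-cases (no  u≮a) (no  u≮b) = trans (cong₂ _+_ (inRange-no (λ (_ , u<b) → u≮b u<b)) (𝟙-no u≮a))
                                       (sym (𝟙-no u≮b))

exceeding : List ℕ → ℕ → ℕ
exceeding []      u = 0
exceeding (x ∷ s) u = 𝟙[ u < x ] + exceeding s u

-- f_{2u} in μ(s), for r = 1 + length s
multiplicity : List ℕ → ℕ → ℕ
multiplicity s u = sumBelow (length s) (λ k → suc k * inRange (at s (suc k)) (at s k) u)

2*%2≡0 : ∀ u → 2 * u % 2 ≡ 0
2*%2≡0 u = trans (cong (_% 2) (*-comm 2 u)) (m*n%n≡0 u 2)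

mult-odd : ∀ r s u → mult r s (suc (2 * u)) ≡ 0
mult-odd r s u with suc (2 * u) % 2 ℕ.≟ 0
... | no  _     = refl
... | yes odd≡0 = ⊥-elim (%2-suc-≢ (2 * u) (trans (2*%2≡0 u) (sym odd≡0)))

mult-even : ∀ s u → mult (suc (length s)) s (2 * u) ≡ multiplicity s u
mult-even s u with 2 * u % 2 ℕ.≟ 0
... | yes _     = cong (multiplicity s) (trans (cong (_/ 2) (*-comm 2 u)) (m*n/n≡m u 2))
... | no  even≢0 = ⊥-elim (even≢0 (2*%2≡0 u))

telescope : ∀ s u → NonIncreasing s →
            sumBelow (length s) (λ k → inRange (at s (suc k)) (at s k) u) ≡ 𝟙[ u < at s 0 ]
telescope []       u _          = sym (𝟙-no {u} {0} (λ ()))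
telescope (x ∷ s′) u (y≤x , ni) =
  trans (sumBelow-sucˡ (length s′) _)
        (trans (cong (inRange (at s′ 0) x u +_) (telescope s′ u ni)) (inRange+𝟙 u y≤x))

-- j · [s_{j+1} ≤ u < s_j] summed over j telescopes to the number of s_j exceeding u
multiplicity≡exceeding : ∀ s u → NonIncreasing s → multiplicity s u ≡ exceeding s u
multiplicity≡exceeding []       u _          = refl
multiplicity≡exceeding (x ∷ s′) u (y≤x , ni) = begin
  multiplicity (x ∷ s′) u
    ≡⟨ sumBelow-sucˡ (length s′) (λ k → suc k * inRange (at (x ∷ s′) (suc k)) (at (x ∷ s′) k) u) ⟩
  1 * inRange y x u + sumBelow (length s′) (λ k → I k + suc k * I k)
    ≡⟨ cong (1 * inRange y x u +_) (sumBelow-+ (length s′) I (λ k → suc k * I k)) ⟩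
  1 * inRange y x u + (sumBelow (length s′) I + multiplicity s′ u)
    ≡⟨ cong₂ (λ a b → a + (b + multiplicity s′ u)) (*-identityˡ (inRange y x u)) (telescope s′ u ni) ⟩
  inRange y x u + (𝟙[ u < y ] + multiplicity s′ u)
    ≡⟨ +-assoc (inRange y x u) _ _ ⟨
  inRange y x u + 𝟙[ u < y ] + multiplicity s′ u
    ≡⟨ cong₂ _+_ (inRange+𝟙 u y≤x) (multiplicity≡exceeding s′ u ni) ⟩
  𝟙[ u < x ] + exceeding s′ u
    ∎
  where
  open ≡-Reasoning
  y : ℕ
  y = at s′ 0
  I : ℕ → ℕ
  I k = inRange (at s′ (suc k)) (at s′ k) u

sumBelow-𝟙 : ∀ {x} n g → x ≤ n → sumBelow n (λ u → g u * 𝟙[ u < x ]) ≡ sumBelow x g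
sumBelow-𝟙 {x} n g x≤n with m≤n⇒m<n∨m≡n x≤n
sumBelow-𝟙 {x} (suc n) g x≤n | inj₁ (s≤s x≤n′) = begin
  sumBelow (suc n) (λ u → g u * 𝟙[ u < x ]) ≡⟨ sumBelow-suc n _ ⟩
  sumBelow n (λ u → g u * 𝟙[ u < x ]) + g n * 𝟙[ n < x ]
    ≡⟨ cong₂ _+_ (sumBelow-𝟙 n g x≤n′) (cong (g n *_) (𝟙-no (λ n<x → <⇒≱ n<x x≤n′))) ⟩
  sumBelow x g + g n * 0                    ≡⟨ cong (sumBelow x g +_) (*-zeroʳ (g n)) ⟩
  sumBelow x g + 0                          ≡⟨ +-identityʳ _ ⟩
  sumBelow x g                              ∎
  where open ≡-Reasoning
... | inj₂ refl = sumBelow-cong n (λ {u} u<n → trans (cong (g u *_) (𝟙-yes u<n)) (*-identityʳ (g u)))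

sumBelow-exceeding : ∀ s n g → NonIncreasing s → at s 0 ≤ n →
                     sumBelow n (λ u → g u * exceeding s u) ≡ sum (map (λ x → sumBelow x g) s)
sumBelow-exceeding []       n g _          _   = sumBelow-0 n (λ u → *-zeroʳ (g u))
sumBelow-exceeding (x ∷ s′) n g (y≤x , ni) x≤n =
  trans (sumBelow-cong n (λ {u} _ → *-distribˡ-+ (g u) 𝟙[ u < x ] (exceeding s′ u)))
        (trans (sumBelow-+ n _ _)
               (cong₂ _+_ (sumBelow-𝟙 n g x≤n) (sumBelow-exceeding s′ n g ni (≤-trans y≤x x≤n))))

weightμ-closed : ∀ s → NonIncreasing s → weightμ (suc (length s)) s ≡ sum (map (λ x → x * (x ∸ 1)) s)
weightμ-closed s ni = begin
  weightμ (suc (length s)) s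
    ≡⟨ sumBelow-double (at s 0) (λ v → v * mult r s v) ⟩
  sumBelow (at s 0) (λ u → 2 * u * mult r s (2 * u) + suc (2 * u) * mult r s (suc (2 * u)))
    ≡⟨ sumBelow-cong (at s 0) (λ {u} _ → cong₂ (λ a b → 2 * u * a + suc (2 * u) * b)
                                                (trans (mult-even s u) (multiplicity≡exceeding s u ni))
                                                (mult-odd r s u)) ⟩
  sumBelow (at s 0) (λ u → 2 * u * exceeding s u + suc (2 * u) * 0)
    ≡⟨ sumBelow-cong (at s 0) (λ {u} _ → trans (cong (2 * u * exceeding s u +_) (*-zeroʳ (suc (2 * u))))
                                                (+-identityʳ _)) ⟩
  sumBelow (at s 0) (λ u → 2 * u * exceeding s u)
    ≡⟨ sumBelow-exceeding s (at s 0) (2 *_) ni ≤-refl ⟩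
  sum (map (λ x → sumBelow x (2 *_)) s)
    ≡⟨ cong sum (map-cong sumBelow-2* s) ⟩
  sum (map (λ x → x * (x ∸ 1)) s)
    ∎
  where
  open ≡-Reasoning
  r : ℕ
  r = suc (length s)

head≤1+weightμ : ∀ s → NonIncreasing s → at s 0 ≤ suc (weightμ (suc (length s)) s)
head≤1+weightμ []      _  = z≤n
head≤1+weightμ (x ∷ s) ni = subst (λ w → x ≤ suc w) (sym (weightμ-closed (x ∷ s) ni))
  (≤-trans (x≤1+[x∸1] x) (s≤s (≤-trans (x∸1≤x*[x∸1] x) (m≤m+n _ _))))
  where
  x≤1+[x∸1] : ∀ x → x ≤ suc (x ∸ 1)
  x≤1+[x∸1] zero    = z≤n
  x≤1+[x∸1] (suc x) = ≤-refl
  x∸1≤x*[x∸1] : ∀ x → x ∸ 1 ≤ x * (x ∸ 1)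
  x∸1≤x*[x∸1] zero    = z≤n
  x∸1≤x*[x∸1] (suc x) = m≤m+n x (x * x)

nonIncreasing? : ∀ s → Dec (NonIncreasing s)
nonIncreasing? []      = yes tt
nonIncreasing? (x ∷ s) = (at s 0 ≤? x) ×-dec nonIncreasing? s

Admissible⇔ : ∀ r s → Admissible r s ⇔ (length s ≡ r ∸ 1 × NonIncreasing s)
Admissible⇔ r s = mk⇔
  (λ (len , step) → len ,
     ⇒nonIncreasing s (λ j j<len → step (suc j) (s≤s z≤n) (subst (suc (suc j) ≤_) len j<len)))
  (λ (len , ni) → len , λ { (suc j) _ _ → nonIncreasing⇒ s ni j })
  where
  nonIncreasing⇒ : ∀ s → NonIncreasing s → ∀ j → at s (suc j) ≤ at s j
  nonIncreasing⇒ []      _         j       = z≤n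
  nonIncreasing⇒ (x ∷ s) (y≤x , _) zero    = y≤x
  nonIncreasing⇒ (x ∷ s) (_ , ni)  (suc j) = nonIncreasing⇒ s ni j
  ⇒nonIncreasing : ∀ s → (∀ j → suc j < length s → at s (suc j) ≤ at s j) → NonIncreasing s
  ⇒nonIncreasing []           _    = tt
  ⇒nonIncreasing (x ∷ [])     _    = z≤n , tt
  ⇒nonIncreasing (x ∷ x₂ ∷ s) step =
    step 0 (s≤s (s≤s z≤n)) , ⇒nonIncreasing (x₂ ∷ s) (λ j j< → step (suc j) (s≤s j<))

admissible? : ∀ r s → Dec (Admissible r s)
admissible? r s =
  map′ (from (Admissible⇔ r s)) (to (Admissible⇔ r s)) ((length s ℕ.≟ r ∸ 1) ×-dec nonIncreasing? s)
  where open Equivalence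

admissible⇒nonIncreasing : ∀ r {s} → Admissible r s → NonIncreasing s
admissible⇒nonIncreasing r {s} adm = proj₂ (Equivalence.to (Admissible⇔ r s) adm)

admissible-head≤ : ∀ r s → Admissible r s → at s 0 ≤ suc (weightμ r s)
admissible-head≤ r       []      _          = z≤n
admissible-head≤ zero    (x ∷ s) (() , _)
admissible-head≤ (suc r) (x ∷ s) adm@(refl , _) = head≤1+weightμ (x ∷ s) (admissible⇒nonIncreasing (suc r) adm)

Unique-decs : ∀ m B → Unique (decs m B)
Unique-decs zero    B = [] ∷ []
Unique-decs (suc m) B =
  Unique-concatMap (λ s → at s 0) (λ x → map (x ∷_) (decs m x)) (Unique.upTo⁺ (suc B))
    (λ x → Unique.map⁺ ∷-injectiveʳ (Unique-decs m x))
    (λ z∈ → let (_ , _ , z≡) = ∈-map⁻ _ z∈ in cong (λ s → at s 0) z≡)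

∈-decs⁺ : ∀ {m B s} → length s ≡ m → NonIncreasing s → at s 0 ≤ B → s ∈ decs m B
∈-decs⁺ {zero}  {B} {[]}    _   _          _   = here refl
∈-decs⁺ {suc m} {B} {x ∷ s} len (y≤x , ni) x≤B =
  ∈-concatMap⁺ (λ x → map (x ∷_) (decs m x))
    (lose (∈-upTo⁺ (s≤s x≤B)) (∈-map⁺ (x ∷_) (∈-decs⁺ (suc-injective len) ni y≤x)))

∈-decs⁻ : ∀ {m B s} → s ∈ decs m B → length s ≡ m × NonIncreasing s × at s 0 ≤ B
∈-decs⁻ {zero}  (here refl) = refl , tt , z≤n
∈-decs⁻ {suc m} {B} s∈
  with x , x∈ , s∈x ← find (∈-concatMap⁻ (λ x → map (x ∷_) (decs m x)) {upTo (suc B)} s∈)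
  with s′ , s′∈ , refl ← ∈-map⁻ (x ∷_) s∈x
  with len , ni , y≤x ← ∈-decs⁻ {m} s′∈ = cong suc len , (y≤x , ni) , ≤-pred (∈-upTo⁻ x∈)

decs⇒admissible : ∀ {r B s} → s ∈ decs (r ∸ 1) B → Admissible r s
decs⇒admissible {r} {B} {s} s∈ =
  let (len , ni , _) = ∈-decs⁻ s∈ in Equivalence.from (Admissible⇔ r s) (len , ni)

sumBelow-at : ∀ (f : ℕ → ℕ) s → sumBelow (length s) (f ∘ at s) ≡ sum (map f s)
sumBelow-at f []      = refl
sumBelow-at f (x ∷ s) = trans (sumBelow-sucˡ (length s) _) (cong (f x +_) (sumBelow-at f s))

Sig-closed : ∀ s → Sig (suc (length s)) s ≡ sum (map (λ x → x * x) s)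
Sig-closed = sumBelow-at (λ x → x * x)

sRange-drop : ∀ i s → sRange s (suc i) (suc (length s)) ≡ sum (drop i s)
sRange-drop zero    s       = trans (sumBelow-at id s) (cong sum (map-id s))
sRange-drop (suc i) []      = refl
sRange-drop (suc i) (x ∷ s) = sRange-drop i s

sRange-take : ∀ i s → sRange s 1 (suc i) ≡ sum (take i s)
sRange-take zero    s       = refl
sRange-take (suc i) []      = sumBelow-0 (suc i) (λ _ → refl)
sRange-take (suc i) (x ∷ s) = trans (sumBelow-sucˡ i _) (cong (x +_) (sRange-take i s))

sum-squares : ∀ s → sum (map (λ x → x * x) s) ≡ sum (map (λ x → x * (x ∸ 1)) s) + sum s
sum-squares []      = refl
sum-squares (x ∷ s) = trans (cong₂ _+_ (square x) (sum-squares s)) (interchange (x * (x ∸ 1)) x _ _)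
  where
  square : ∀ x → x * x ≡ x * (x ∸ 1) + x
  square zero    = refl
  square (suc x) = trans (cong (suc x +_) (*-comm x (suc x))) (+-comm (suc x) (suc x * x))

Nn-closed : ∀ i s → Nn (suc (length s)) i s ≡ sum (map (λ x → x * (x ∸ 1)) s) + sum (drop i s)
Nn-closed i s = begin
  Sig (suc (length s)) s ∸ sRange s 1 (suc i)            ≡⟨ cong₂ _∸_ (Sig-closed s) (sRange-take i s) ⟩
  sum (map (λ x → x * x) s) ∸ sum (take i s)              ≡⟨ cong (_∸ sum (take i s)) (sum-squares s) ⟩
  W + sum s ∸ sum (take i s)                              ≡⟨ cong (λ t → W + t ∸ sum (take i s)) split ⟩
  W + (sum (take i s) + sum (drop i s)) ∸ sum (take i s)
    ≡⟨ cong (_∸ sum (take i s)) (x∙yz≈y∙xz W (sum (take i s)) (sum (drop i s))) ⟩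
  sum (take i s) + (W + sum (drop i s)) ∸ sum (take i s)  ≡⟨ m+n∸m≡n (sum (take i s)) _ ⟩
  W + sum (drop i s)                                      ∎
  where
  open ≡-Reasoning
  W : ℕ
  W = sum (map (λ x → x * (x ∸ 1)) s)
  split : sum s ≡ sum (take i s) + sum (drop i s)
  split = trans (cong sum (sym (take++drop≡id i s))) (sum-++ (take i s) (drop i s))

minWeight-+ : ∀ b b′ s → minWeight (λ j → b j + b′ j) s ≡ minWeight b s + minWeight b′ s
minWeight-+ b b′ []      = refl
minWeight-+ b b′ (x ∷ s) =
  trans (cong₂ _+_ (*-distribʳ-+ (x ∸ at s 0) (b 1) (b′ 1)) (minWeight-+ (b ∘ suc) (b′ ∘ suc) s))
        (interchange (b 1 * (x ∸ at s 0)) _ _ _)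

minWeight-cong : ∀ {b b′} s → (∀ j → b j ≡ b′ j) → minWeight b s ≡ minWeight b′ s
minWeight-cong []      eq = refl
minWeight-cong (x ∷ s) eq = cong₂ _+_ (cong (_* (x ∸ at s 0)) (eq 1)) (minWeight-cong s (eq ∘ suc))

minWeight-+c : ∀ c s → NonIncreasing s → minWeight (c +_) s ≡ c * at s 0 + sum s
minWeight-+c c []      _          = sym (trans (+-identityʳ _) (*-zeroʳ c))
minWeight-+c c (x ∷ s) (y≤x , ni) = begin
  (c + 1) * (x ∸ y) + minWeight (λ j → c + suc j) s
    ≡⟨ cong₂ (λ a m → a * (x ∸ y) + m) (+-comm c 1)
             (trans (minWeight-cong s (+-suc c)) (minWeight-+c (suc c) s ni)) ⟩
  suc c * (x ∸ y) + (suc c * y + sum s) ≡⟨ +-assoc (suc c * (x ∸ y)) _ _ ⟨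
  suc c * (x ∸ y) + suc c * y + sum s   ≡⟨ cong (_+ sum s) (*-distribˡ-+ (suc c) (x ∸ y) y) ⟨
  suc c * (x ∸ y + y) + sum s           ≡⟨ cong (λ z → suc c * z + sum s) (m∸n+n≡m y≤x) ⟩
  x + c * x + sum s                     ≡⟨ cong (_+ sum s) (+-comm x (c * x)) ⟩
  c * x + x + sum s                     ≡⟨ +-assoc (c * x) x (sum s) ⟩
  c * x + (x + sum s)                   ∎
  where
  open ≡-Reasoning
  y : ℕ
  y = at s 0

minWeight-∸ : ∀ i s → NonIncreasing s → minWeight (_∸ i) s ≡ sum (drop i s)
minWeight-∸ zero    s       ni       = minWeight-+c 0 s ni
minWeight-∸ (suc i) []      _        = refl
minWeight-∸ (suc i) (x ∷ s) (_ , ni) =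
  trans (cong (λ a → a * (x ∸ at s 0) + minWeight (_∸ i) s) (0∸n≡0 i)) (minWeight-∸ i s ni)

Nn≡weightμ+minWeight : ∀ {m} s → Admissible (suc m) s → ∀ i →
                       Nn (suc m) i s ≡ weightμ (suc m) s + minWeight (_∸ i) s
Nn≡weightμ+minWeight s adm@(refl , _) i =
  trans (Nn-closed i s) (sym (cong₂ _+_ (weightμ-closed s ni) (minWeight-∸ i s ni)))
  where
  ni : NonIncreasing s
  ni = admissible⇒nonIncreasing (suc (length s)) adm

Sig+sRange≡weightμ+minWeight : ∀ {m} s → Admissible (suc m) s → ∀ i →
  Sig (suc m) s + sRange s (suc i) (suc m) ≡ weightμ (suc m) s + minWeight (λ j → j + (j ∸ i)) s
Sig+sRange≡weightμ+minWeight s adm@(refl , _) i = begin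
  Sig r s + sRange s (suc i) r                ≡⟨ cong₂ _+_ (Sig-closed s) (sRange-drop i s) ⟩
  sum (map (λ x → x * x) s) + sum (drop i s)  ≡⟨ cong (_+ sum (drop i s)) (sum-squares s) ⟩
  W + sum s + sum (drop i s)                  ≡⟨ +-assoc W (sum s) (sum (drop i s)) ⟩
  W + (sum s + sum (drop i s))
    ≡⟨ cong₂ _+_ (weightμ-closed s ni) (trans (minWeight-+ id (_∸ i) s)
                                               (cong₂ _+_ (minWeight-+c 0 s ni) (minWeight-∸ i s ni))) ⟨
  weightμ r s + minWeight (λ j → j + (j ∸ i)) s ∎
  where
  open ≡-Reasoning
  r W : ℕ
  r = suc (length s)
  W = sum (map (λ x → x * (x ∸ 1)) s)
  ni : NonIncreasing s
  ni = admissible⇒nonIncreasing r adm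

Nn-step : ∀ {m} s → Admissible (suc m) s → ∀ i → suc i ≤ m →
          Nn (suc m) (suc i) s + sj s (suc i) ≡ Nn (suc m) i s
Nn-step s (refl , _) i i<len = begin
  Nn r (suc i) s + at s i                ≡⟨ cong (_+ at s i) (Nn-closed (suc i) s) ⟩
  W + sum (drop (suc i) s) + at s i      ≡⟨ +-assoc W _ (at s i) ⟩
  W + (sum (drop (suc i) s) + at s i)    ≡⟨ cong (W +_) (trans (+-comm _ (at s i)) (sym (sum-drop i s i<len))) ⟩
  W + sum (drop i s)                     ≡⟨ Nn-closed i s ⟨
  Nn r i s                               ∎
  where
  open ≡-Reasoning
  r W : ℕ
  r = suc (length s)
  W = sum (map (λ x → x * (x ∸ 1)) s)
  sum-drop : ∀ i s → suc i ≤ length s → sum (drop i s) ≡ at s i + sum (drop (suc i) s)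
  sum-drop zero    (x ∷ s) _        = refl
  sum-drop (suc i) (x ∷ s) (s≤s i<) = sum-drop i s i<

Nn-two-steps : ∀ {m} s → Admissible (suc m) s → ∀ i → 2 + i ≤ m →
               Nn (suc m) (2 + i) s + (sj s (2 + i) + sj s (suc i)) ≡ Nn (suc m) i s
Nn-two-steps s adm i i< = trans (sym (+-assoc _ (sj s (2 + i)) (sj s (suc i))))
  (trans (cong (_+ sj s (suc i)) (Nn-step s adm (suc i) i<)) (Nn-step s adm i (≤-trans (n≤1+n (suc i)) i<)))

-- Assembling the multisum

-- Since s_1 ≤ 1 + |μ(s)|, every element of weight n has s_1 ≤ n + 1, so the partial multisums
-- are stable from B = n + 1 on.
module _ (r : ℕ) {A : Elem → Set} {T : List ℕ → FPS}
         (A⇒admissible : ∀ {s l} → A (s , l) → Admissible r s)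
         (fibre : ∀ s → Admissible r s → Enumeration (λ l → A (s , l)) (λ l → weight r (s , l)) (T s)) where

  private
    fibreList : ∀ s → Dec (Admissible r s) → ℕ → List (List ℕ)
    fibreList s (yes adm) n = list (fibre s adm) n
    fibreList s (no  _)   n = []

    elements : ℕ → ℕ → List Elem
    elements B n = concatMap (λ s → map (s ,_) (fibreList s (admissible? r s) n)) (decs (r ∸ 1) B)

    elements-unique : ∀ B n → Unique (elements B n)
    elements-unique B n = Unique-concatMap proj₁ _ (Unique-decs (r ∸ 1) B)
      (λ s → Unique.map⁺ (λ { refl → refl }) (fibreList-unique s (admissible? r s)))
      (λ z∈ → let (_ , _ , z≡) = ∈-map⁻ _ z∈ in cong proj₁ z≡)
      where
      fibreList-unique : ∀ s dec → Unique (fibreList s dec n)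
      fibreList-unique s (yes adm) = unique (fibre s adm) n
      fibreList-unique s (no  _)   = []

    elements-sound : ∀ B n {z} → z ∈ elements B n → A z × weight r z ≡ n
    elements-sound B n z∈
      with s , _ , z∈s ← find (∈-concatMap⁻ (λ s → map (s ,_) (fibreList s (admissible? r s) n))
                                             {decs (r ∸ 1) B} z∈)
      with l , l∈ , refl ← ∈-map⁻ (s ,_) z∈s = fibreList-sound (admissible? r s) l∈
      where
      fibreList-sound : ∀ {s l} dec → l ∈ fibreList s dec n → A (s , l) × weight r (s , l) ≡ n
      fibreList-sound {s} (yes adm) l∈ = sound (fibre s adm) l∈

    elements-complete : ∀ B n → n < B → ∀ {z} → A z → weight r z ≡ n → z ∈ elements B n
    elements-complete B n n<B {s , l} a refl =
      ∈-concatMap⁺ (λ s → map (s ,_) (fibreList s (admissible? r s) n)) {decs (r ∸ 1) B}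
        (lose (∈-decs⁺ (proj₁ adm) (admissible⇒nonIncreasing r adm)
                       (≤-trans (admissible-head≤ r s adm) (≤-trans (s≤s (m≤m+n _ _)) n<B)))
              (∈-map⁺ (s ,_) (fibreList-complete (admissible? r s))))
      where
      adm : Admissible r s
      adm = A⇒admissible a
      fibreList-complete : ∀ dec → l ∈ fibreList s dec n
      fibreList-complete (yes adm′) = complete (fibre s adm′) a refl
      fibreList-complete (no ¬adm)  = ⊥-elim (¬adm adm)

    partialCoeff≡length : ∀ B n → partialCoeff r T B n ≡ ℤ.+ length (elements B n)
    partialCoeff≡length B n = sumℤ-length (λ s → map (s ,_) (fibreList s (admissible? r s) n)) (decs (r ∸ 1) B)
      (λ {s} s∈ → trans (fibreList-coeff (admissible? r s) (decs⇒admissible {r} s∈))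
                         (cong ℤ.+_ (sym (length-map (s ,_) (fibreList s (admissible? r s) n)))))
      where
      fibreList-coeff : ∀ {s} dec → Admissible r s → T s n ≡ ℤ.+ length (fibreList s dec n)
      fibreList-coeff {s} (yes adm) _   = coeff (fibre s adm) n
      fibreList-coeff     (no ¬adm) adm = ⊥-elim (¬adm adm)

  GFEq-fibres : GFEq r A T
  GFEq-fibres n =
    length (elements (suc n) n) ,
    (elements (suc n) n , elements-unique (suc n) n , (λ _ → elements-sound (suc n) n) ,
     (λ _ → elements-complete (suc n) n ≤-refl) , refl) ,
    (suc n , λ B n<B → trans (partialCoeff≡length B n)
      (cong ℤ.+_ (length-unique (elements-unique B n) (elements-unique (suc n) n)
        (λ z∈ → let (a , w) = elements-sound B n z∈ in elements-complete (suc n) n ≤-refl a w)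
        (λ z∈ → let (a , w) = elements-sound (suc n) n z∈ in elements-complete B n n<B a w))))

length-filter-∁ : ∀ {X : Set} {P : X → Set} (P? : Decidable P) xs →
                  length (filter P? xs) + length (filter (¬? ∘ P?) xs) ≡ length xs
length-filter-∁ P? []       = refl
length-filter-∁ P? (x ∷ xs) with does (P? x)
... | true  = cong suc (length-filter-∁ P? xs)
... | false = trans (+-suc _ _) (cong suc (length-filter-∁ P? xs))

module _ {r : ℕ} {A : Elem → Set} where

  GFEq-cong : ∀ {T T′} → GFEq r A T → (∀ s → Admissible r s → T s ≗ T′ s) → GFEq r A T′
  GFEq-cong gf T≗T′ n with c , count , B , stable ← gf n =
    c , count , B , λ B′ B≤B′ →
      trans (sym (sumℤ-cong (decs (r ∸ 1) B′) λ s∈ → T≗T′ _ (decs⇒admissible {r} s∈) n)) (stable B′ B≤B′)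

  GFEq-∖ : ∀ {B TA TB} → (∀ x → B x → A x) → GFEq r A TA → GFEq r B TB →
           GFEq r (A ∖ B) (λ s → TA s ⊖ TB s)
  GFEq-∖ {B} {TA} {TB} B⇒A gfA gfB n
    with _ , (LA , LA! , soundA , completeA , refl) , NA , stableA ← gfA n
       | _ , (LB , LB! , soundB , completeB , refl) , NB , stableB ← gfB n =
    length rest , (rest , Unique.filter⁺ _ LA! , rest-sound , rest-complete , refl) , NA ⊔ NB , stable
    where
    inB? : Decidable (_∈ LB)
    inB? x = x ∈? LB
    rest : List Elem
    rest = filter (¬? ∘ inB?) LA
    rest-sound : ∀ x → x ∈ rest → (A ∖ B) x × weight r x ≡ n
    rest-sound x x∈ with x∈LA , x∉LB ← ∈-filter⁻ (¬? ∘ inB?) {xs = LA} x∈ =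
      let (a , w) = soundA x x∈LA in (a , λ b → x∉LB (completeB x b w)) , w
    rest-complete : ∀ x → (A ∖ B) x → weight r x ≡ n → x ∈ rest
    rest-complete x (a , ¬b) w =
      ∈-filter⁺ (¬? ∘ inB?) (completeA x a w) (λ x∈LB → ¬b (proj₁ (soundB x x∈LB)))
    length-common : length (filter inB? LA) ≡ length LB
    length-common = length-unique (Unique.filter⁺ inB? LA!) LB!
      (λ x∈ → proj₂ (∈-filter⁻ inB? {xs = LA} x∈))
      (λ {x} x∈LB → let (b , w) = soundB x x∈LB in ∈-filter⁺ inB? (completeA x (B⇒A x b) w) x∈LB)
    stable : ∀ N → NA ⊔ NB ≤ N → partialCoeff r (λ s → TA s ⊖ TB s) N n ≡ ℤ.+ length rest
    stable N N≥ = begin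
      partialCoeff r (λ s → TA s ⊖ TB s) N n
        ≡⟨ sumℤ-map-- (λ s → TA s n) (λ s → TB s n) (decs (r ∸ 1) N) ⟩
      partialCoeff r TA N n -ℤ partialCoeff r TB N n
        ≡⟨ cong₂ _-ℤ_ (stableA N (≤-trans (m≤m⊔n NA NB) N≥)) (stableB N (≤-trans (m≤n⊔m NA NB) N≥)) ⟩
      ℤ.+ length LA -ℤ ℤ.+ length LB
        ≡⟨ cong (λ c → ℤ.+ c -ℤ ℤ.+ length LB) (sym (length-filter-∁ inB? LA)) ⟩
      ℤ.+ (length (filter inB? LA) + length rest) -ℤ ℤ.+ length LB
        ≡⟨ cong (λ c → ℤ.+ (c + length rest) -ℤ ℤ.+ length LB) length-common ⟩
      ℤ.+ (length LB + length rest) -ℤ ℤ.+ length LB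
        ≡⟨ cong (_-ℤ ℤ.+ length LB) (ℤ.pos-+ (length LB) (length rest)) ⟩
      (ℤ.+ length LB +ℤ ℤ.+ length rest) -ℤ ℤ.+ length LB
        ≡⟨ cancel (ℤ.+ length LB) (ℤ.+ length rest) ⟩
      ℤ.+ length rest
        ∎
      where
      open ≡-Reasoning
      cancel : ∀ a b → (a +ℤ b) -ℤ a ≡ b
      cancel = ℤ-Solver.solve-∀

LowerFamily : ℕ → (ℕ → ℕ) → Elem → Set
LowerFamily r b (s , l) = (Admissible r s × InP r s l) × LowerB r b s l

ParityFamily : ℕ → (ℕ → ℕ) → ℕ → Elem → Set
ParityFamily r b p (s , l) = LowerFamily r b (s , l) × Parity r p s l

qpow-cong : ∀ {a b} f → a ≡ b → qpow a ⊗ f ≗ qpow b ⊗ f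
qpow-cong f a≡b n = cong (λ a → (qpow a ⊗ f) n) a≡b

withμ : ∀ r s (A : Elem → Set) {F : List ℕ → Set} {k D} → Combinatorial D →
        (∀ {l} → F l → A (s , l)) → (∀ {l} → A (s , l) → F l) → Enumeration F sum (qpow k ⊗ D) →
        Enumeration (λ l → A (s , l)) (λ l → weight r (s , l)) (qpow (weightμ r s + k) ⊗ D)
withμ r s A {k = k} 𝔇 F⇒A A⇒F E = Enumeration-resp-≗ (qpow-⊗-assoc 𝔇 (weightμ r s) k) (transport (record
  { to = proj₂ ; from = tt ,_ ; to-∈ = λ (_ , f) → F⇒A f ; from-∈ = λ a → tt , A⇒F a
  ; to-from = λ _ → refl ; from-to = λ _ → refl ; weight-to = λ _ → refl })
  (qpowEnum (weightμ r s) ⊗ᴱ E))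

lowerFamilyFibre : ∀ {m} b s → length s ≡ m → NonIncreasing s →
                   Enumeration (λ l → LowerFamily (suc m) b (s , l)) (λ l → weight (suc m) (s , l))
                               (qpow (weightμ (suc m) s + minWeight b s) ⊗ invD1 (suc m) s)
lowerFamilyFibre b s refl ni =
  withμ r s (LowerFamily r b) (Combinatorial-invD1 r s)
    (λ (inP , low) → (adm , inP) , low) (λ ((_ , inP) , low) → inP , low) (lowerFibreEnum b s ni)
  where
  r : ℕ
  r = suc (length s)
  adm : Admissible r s
  adm = Equivalence.from (Admissible⇔ r s) (refl , ni)

parityFamilyFibre : ∀ {m} b p e s → length s ≡ suc m → NonIncreasing s →
                    ParityFloor (b (suc m)) p (b (suc m) + e) →
                    Enumeration (λ l → ParityFamily (suc (suc m)) b p (s , l)) (λ l → weight (suc (suc m)) (s , l))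
                                (qpow (weightμ (suc (suc m)) s + minWeight b s + e * sj s (suc m)) ⊗
                                 invD2 (suc (suc m)) s)
parityFamilyFibre b p e s@(x ∷ s′) refl ni floor =
  Enumeration-resp-≗ (qpow-cong (invD2 r s) (sym (+-assoc (weightμ r s) (minWeight b s) (e * sj s (length s)))))
    (withμ r s (ParityFamily r b p) (Combinatorial-invD2 r s)
      (λ ((inP , low) , par) → ((adm , inP) , low) , par) (λ (((_ , inP) , low) , par) → (inP , low) , par)
      (parityFibreEnum b p e x s′ ni floor))
  where
  r : ℕ
  r = suc (length s)
  adm : Admissible r s
  adm = Equivalence.from (Admissible⇔ r s) (refl , ni)

GF-lower : ∀ m b → GFEq (suc m) (LowerFamily (suc m) b)
                        (λ s → qpow (weightμ (suc m) s + minWeight b s) ⊗ invD1 (suc m) s)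
GF-lower m b = GFEq-fibres (suc m) (proj₁ ∘ proj₁)
  (λ s adm → lowerFamilyFibre b s (proj₁ adm) (admissible⇒nonIncreasing (suc m) adm))

GF-parity : ∀ m b p e → ParityFloor (b (suc m)) p (b (suc m) + e) →
            GFEq (suc (suc m)) (ParityFamily (suc (suc m)) b p)
                 (λ s → qpow (weightμ (suc (suc m)) s + minWeight b s + e * sj s (suc m)) ⊗ invD2 (suc (suc m)) s)
GF-parity m b p e floor = GFEq-fibres (suc (suc m)) (proj₁ ∘ proj₁ ∘ proj₁)
  (λ s adm → parityFamilyFibre b p e s (proj₁ adm) (admissible⇒nonIncreasing (suc (suc m)) adm) floor)

+0* : ∀ {a b} x → a ≡ b → a + 0 * x ≡ b
+0* {a} x a≡b = trans (+-identityʳ a) a≡b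

+1* : ∀ {a b} x → a ≡ b → a + 1 * x ≡ b + x
+1* x a≡b = cong₂ _+_ a≡b (+-identityʳ x)

difference-series : ∀ N {N₁ N₂} a b D → N + a ≡ N₁ → N + b ≡ N₂ →
                    (qpow N ⊗ (qpow a ⊖ qpow b)) ⊗ D ≗ (qpow N₁ ⊗ D) ⊖ (qpow N₂ ⊗ D)
difference-series N a b D refl refl n = begin
  ((qpow N ⊗ (qpow a ⊖ qpow b)) ⊗ D) n
    ≡⟨ ⊗-congʳ D (⊗-distribˡ-⊖ (qpow N) (qpow a) (qpow b)) n ⟩
  (((qpow N ⊗ qpow a) ⊖ (qpow N ⊗ qpow b)) ⊗ D) n
    ≡⟨ ⊗-distribʳ-⊖ (qpow N ⊗ qpow a) (qpow N ⊗ qpow b) D n ⟩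
  ((qpow N ⊗ qpow a) ⊗ D) n -ℤ ((qpow N ⊗ qpow b) ⊗ D) n
    ≡⟨ cong₂ _-ℤ_ (⊗-congʳ D (qpow-+ N a) n) (⊗-congʳ D (qpow-+ N b) n) ⟩
  (qpow (N + a) ⊗ D) n -ℤ (qpow (N + b) ⊗ D) n
    ∎
  where open ≡-Reasoning

difference-series₁ : ∀ N {N₂} b D → N + b ≡ N₂ →
                     (qpow N ⊗ (oneS ⊖ qpow b)) ⊗ D ≗ (qpow N ⊗ D) ⊖ (qpow N₂ ⊗ D)
difference-series₁ N b D N+b≡ n =
  trans (⊗-congʳ D (⊗-congˡ (qpow N) (λ k → cong (_-ℤ qpow b k) (oneS≗qpow0 k))) n)
        (difference-series N 0 b D (+-identityʳ N) N+b≡ n)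

LowerB-∸-mono : ∀ r s l {i i′} → i′ ≤ i → LowerB r (_∸ i′) s l → LowerB r (_∸ i) s l
LowerB-∸-mono r s l i′≤i low j 1≤j j≤ lt = ≤-trans (∸-monoʳ-≤ j i′≤i) (low j 1≤j j≤ lt)

GF-𝒫 : ∀ {m} i → GFEq (suc m) (𝒫 (suc m) i) (λ s → qpow (Nn (suc m) i s) ⊗ invD1 (suc m) s)
GF-𝒫 {m} i = GFEq-cong (GF-lower m (_∸ i))
  (λ s adm → qpow-cong (invD1 (suc m) s) (sym (Nn≡weightμ+minWeight s adm i)))

GF-𝒬 : ∀ {m} i → GFEq (suc m) (𝒬 (suc m) i)
                       (λ s → qpow (Sig (suc m) s + sRange s (suc i) (suc m)) ⊗ invD1 (suc m) s)
GF-𝒬 {m} i = GFEq-cong (GF-lower m (λ j → j + (j ∸ i)))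
  (λ s adm → qpow-cong (invD1 (suc m) s) (sym (Sig+sRange≡weightμ+minWeight s adm i)))

GF-𝒫∖𝒫 : ∀ {m} i → suc i ≤ m →
         GFEq (suc m) (𝒫 (suc m) (suc i) ∖ 𝒫 (suc m) i)
              (λ s → (qpow (Nn (suc m) (suc i) s) ⊗ (oneS ⊖ qpow (sj s (suc i)))) ⊗ invD1 (suc m) s)
GF-𝒫∖𝒫 {m} i i< =
  GFEq-cong (GFEq-∖ {A = 𝒫 (suc m) (suc i)} {B = 𝒫 (suc m) i} ⊆ (GF-𝒫 (suc i)) (GF-𝒫 i))
    (λ s adm n → sym (difference-series₁ (Nn (suc m) (suc i) s) (sj s (suc i)) (invD1 (suc m) s)
                                         (Nn-step s adm i i<) n))
  where
  ⊆ : ∀ x → 𝒫 (suc m) i x → 𝒫 (suc m) (suc i) x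
  ⊆ (s , l) (u , low) = u , LowerB-∸-mono (suc m) s l (n≤1+n i) low

module _ {m : ℕ} where
  private
    r : ℕ
    r = suc (suc m)

  GF-ℛ : ∀ i → GFEq r (ℛ r i) (λ s → qpow (Nn r i s) ⊗ invD2 r s)
  GF-ℛ i = GFEq-cong (GF-parity m (_∸ i) (suc m ∸ i) 0 (ParityFloor-+0 refl))
    (λ s adm → qpow-cong (invD2 r s) (+0* (sj s (suc m)) (sym (Nn≡weightμ+minWeight s adm i))))

  GF-ℛ̃ : ∀ i → i ≤ suc m → GFEq r (ℛ̃ r i) (λ s → qpow (Nn r i s + sj s (r ∸ 1)) ⊗ invD2 r s)
  GF-ℛ̃ i i≤ = GFEq-cong (GF-parity m (_∸ i) (r ∸ i) 1 (ParityFloor-+1 (cong (_% 2) (sym (+-∸-assoc 1 i≤)))))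
    (λ s adm → qpow-cong (invD2 r s) (+1* (sj s (suc m)) (sym (Nn≡weightμ+minWeight s adm i))))

  GF-𝒮 : ∀ i → i ≤ suc m → GFEq r (𝒮 r i) (λ s → qpow (Sig r s + sRange s (suc i) r) ⊗ invD2 r s)
  GF-𝒮 i i≤ = GFEq-cong (GF-parity m (λ j → j + (j ∸ i)) i 0 (ParityFloor-+0 (%2-reflect i≤)))
    (λ s adm → qpow-cong (invD2 r s) (+0* (sj s (suc m)) (sym (Sig+sRange≡weightμ+minWeight s adm i))))

  GF-𝒮̃ : ∀ i → i ≤ suc m →
         GFEq r (𝒮̃ r i) (λ s → qpow (Sig r s + sRange s (suc i) r + sj s (r ∸ 1)) ⊗ invD2 r s)
  GF-𝒮̃ i i≤ =
    GFEq-cong (GF-parity m (λ j → j + (j ∸ i)) (suc i) 1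
                         (ParityFloor-+1 (%2-suc-cong {suc m + (suc m ∸ i)} {i} (%2-reflect i≤))))
      (λ s adm → qpow-cong (invD2 r s) (+1* (sj s (suc m)) (sym (Sig+sRange≡weightμ+minWeight s adm i))))

  GF-ℛ∖ℛ̃ : ∀ i → suc i ≤ suc m →
           GFEq r (ℛ r (suc i) ∖ ℛ̃ r i)
                (λ s → (qpow (Nn r (suc i) s) ⊗ (oneS ⊖ qpow (sj s (suc i) + sj s (r ∸ 1)))) ⊗ invD2 r s)
  GF-ℛ∖ℛ̃ i i< =
    GFEq-cong (GFEq-∖ {A = ℛ r (suc i)} {B = ℛ̃ r i} ⊆ (GF-ℛ (suc i)) (GF-ℛ̃ i (≤-trans (n≤1+n i) i<)))
      (λ s adm n → sym (difference-series₁ (Nn r (suc i) s) (sj s (suc i) + sj s (suc m)) (invD2 r s)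
                          (trans (sym (+-assoc (Nn r (suc i) s) (sj s (suc i)) (sj s (suc m))))
                                 (cong (_+ sj s (suc m)) (Nn-step s adm i i<))) n))
    where
    ⊆ : ∀ x → ℛ̃ r i x → ℛ r (suc i) x
    ⊆ (s , l) ((u , low) , par) =
      (u , LowerB-∸-mono r s l (n≤1+n i) low) , λ k k< → trans (par k k<) (%2-∸2 {r} {i} (s≤s i<))

  GF-ℛ̃∖ℛ : ∀ i → suc i ≤ suc m →
           GFEq r (ℛ̃ r (suc i) ∖ ℛ r i)
                (λ s → (qpow (Nn r (suc i) s) ⊗ (qpow (sj s (r ∸ 1)) ⊖ qpow (sj s (suc i)))) ⊗ invD2 r s)
  GF-ℛ̃∖ℛ i i< =
    GFEq-cong (GFEq-∖ {A = ℛ̃ r (suc i)} {B = ℛ r i} ⊆ (GF-ℛ̃ (suc i) i<) (GF-ℛ i))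
      (λ s adm n → sym (difference-series (Nn r (suc i) s) (sj s (suc m)) (sj s (suc i)) (invD2 r s)
                                          refl (Nn-step s adm i i<) n))
    where
    ⊆ : ∀ x → ℛ r i x → ℛ̃ r (suc i) x
    ⊆ (s , l) ((u , low) , par) = (u , LowerB-∸-mono r s l (n≤1+n i) low) , par

  GF-ℛ∖ℛ : ∀ i → 2 + i ≤ suc m →
           GFEq r (ℛ r (2 + i) ∖ ℛ r i)
                (λ s → (qpow (Nn r (2 + i) s) ⊗ (oneS ⊖ qpow (sj s (2 + i) + sj s (suc i)))) ⊗ invD2 r s)
  GF-ℛ∖ℛ i i< =
    GFEq-cong (GFEq-∖ {A = ℛ r (2 + i)} {B = ℛ r i} ⊆ (GF-ℛ (2 + i)) (GF-ℛ i))
      (λ s adm n → sym (difference-series₁ (Nn r (2 + i) s) (sj s (2 + i) + sj s (suc i)) (invD2 r s)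
                                           (Nn-two-steps s adm i i<) n))
    where
    ⊆ : ∀ x → ℛ r i x → ℛ r (2 + i) x
    ⊆ (s , l) ((u , low) , par) =
      (u , LowerB-∸-mono r s l (m≤n+m i 2) low) , λ k k< → trans (par k k<) (%2-∸2 {suc m} {i} i<)

  GF-ℛ̃∖ℛ̃ : ∀ i → 2 + i ≤ suc m →
           GFEq r (ℛ̃ r (2 + i) ∖ ℛ̃ r i)
                (λ s → (qpow (Nn r (2 + i) s + sj s (r ∸ 1)) ⊗ (oneS ⊖ qpow (sj s (2 + i) + sj s (suc i))))
                       ⊗ invD2 r s)
  GF-ℛ̃∖ℛ̃ i i< =
    GFEq-cong (GFEq-∖ {A = ℛ̃ r (2 + i)} {B = ℛ̃ r i} ⊆ (GF-ℛ̃ (2 + i) i<) (GF-ℛ̃ i (≤-trans (m≤n+m i 2) i<)))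
      (λ s adm n → sym (difference-series₁ (Nn r (2 + i) s + sj s (suc m)) (sj s (2 + i) + sj s (suc i))
                                           (invD2 r s) (two-steps s adm) n))
    where
    ⊆ : ∀ x → ℛ̃ r i x → ℛ̃ r (2 + i) x
    ⊆ (s , l) ((u , low) , par) =
      (u , LowerB-∸-mono r s l (m≤n+m i 2) low) ,
      λ k k< → trans (par k k<) (%2-∸2 {r} {i} (≤-trans i< (n≤1+n (suc m))))
    two-steps : ∀ s → Admissible r s →
                Nn r (2 + i) s + sj s (suc m) + (sj s (2 + i) + sj s (suc i)) ≡ Nn r i s + sj s (suc m)
    two-steps s adm = trans (xy∙z≈xz∙y (Nn r (2 + i) s) (sj s (suc m)) _)
                            (cong (_+ sj s (suc m)) (Nn-two-steps s adm i i<))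

mainTheorem9 : ∀ r → 2 ≤ r →
    (∀ i → 1 ≤ i → i ≤ r →
       GFEq r (𝒬 r (i ∸ 1)) (λ s → qpow (Sig r s + sRange s i r) ⊗ invD1 r s)
     × GFEq r (𝒮 r (i ∸ 1)) (λ s → qpow (Sig r s + sRange s i r) ⊗ invD2 r s)
     × GFEq r (𝒮̃ r (i ∸ 1)) (λ s → qpow (Sig r s + sRange s i r + sj s (r ∸ 1)) ⊗ invD2 r s))
    × (∀ i → i ≤ r ∸ 1 →
       GFEq r (𝒫 r i) (λ s → qpow (Nn r i s) ⊗ invD1 r s)
     × GFEq r (ℛ r i) (λ s → qpow (Nn r i s) ⊗ invD2 r s)
     × GFEq r (ℛ̃ r i) (λ s → qpow (Nn r i s + sj s (r ∸ 1)) ⊗ invD2 r s))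
    × (∀ i → 1 ≤ i → i ≤ r ∸ 1 →
       GFEq r (𝒫 r i ∖ 𝒫 r (i ∸ 1))
         (λ s → (qpow (Nn r i s) ⊗ (oneS ⊖ qpow (sj s i))) ⊗ invD1 r s)
     × GFEq r (ℛ r i ∖ ℛ̃ r (i ∸ 1))
         (λ s → (qpow (Nn r i s) ⊗ (oneS ⊖ qpow (sj s i + sj s (r ∸ 1)))) ⊗ invD2 r s)
     × GFEq r (ℛ̃ r i ∖ ℛ r (i ∸ 1))
         (λ s → (qpow (Nn r i s) ⊗ (qpow (sj s (r ∸ 1)) ⊖ qpow (sj s i))) ⊗ invD2 r s))
    × (∀ i → 2 ≤ i → i ≤ r ∸ 1 →
       GFEq r (ℛ r i ∖ ℛ r (i ∸ 2))
         (λ s → (qpow (Nn r i s) ⊗ (oneS ⊖ qpow (sj s i + sj s (i ∸ 1)))) ⊗ invD2 r s)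
     × GFEq r (ℛ̃ r i ∖ ℛ̃ r (i ∸ 2))
         (λ s → (qpow (Nn r i s + sj s (r ∸ 1)) ⊗ (oneS ⊖ qpow (sj s i + sj s (i ∸ 1)))) ⊗ invD2 r s))
mainTheorem9 (suc (suc m)) (s≤s (s≤s z≤n)) =
  (λ { (suc i) _ (s≤s i≤) → GF-𝒬 i , GF-𝒮 i i≤ , GF-𝒮̃ i i≤ }) ,
  (λ i i≤ → GF-𝒫 i , GF-ℛ i , GF-ℛ̃ i i≤) ,
  (λ { (suc i) _ i< → GF-𝒫∖𝒫 i i< , GF-ℛ∖ℛ̃ i i< , GF-ℛ̃∖ℛ i i< }) ,
  (λ { (suc zero) (s≤s ()) _ ; (suc (suc i)) _ i< → GF-ℛ∖ℛ i i< , GF-ℛ̃∖ℛ̃ i i< })
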